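{- Let $T_\omega(n)$ be as defined in the context and let $\omega(q)=\sum_{n\ge0}\frac{q^{2n^2+2n}}{(q;q^2)_{n+1}^2}$. Then, as formal power series (equivalently for $|q|<1$), $$\sum_{n\ge1}T_\omega(n)q^n=q\,\omega(q).$$
   Context: $(a;q)_n=\prod_{j=0}^{n-1}(1-aq^j)$, $(a;q)_\infty=\prod_{j\ge0}(1-aq^j)$. A two-color partition is a partition whose parts are each colored blue or green (the same integer may occur in both colors). $T_\omega(n)$ is the signed count of two-color partitions of $n$ such that: all even parts are blue and the even parts are distinct; the smallest part $s$ is odd and occurs at least once in blue; (all green parts are odd; odd parts of either color may repeat). Each such partition is counted with weight $(-1)^j$, where $j$ is the number of even parts. Equivalently, $\sum_{n\ge1}T_\omega(n)q^n=\sum_{n\ge0}\frac{q^{2n+1}(q^{2n+2};q^2)_\infty}{(q^{2n+1};q^2)_\infty^2}$. -}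

module Defs where

open import Data.Nat as ℕ using (ℕ; zero; suc; _∸_; _≤ᵇ_; _≡ᵇ_)
open import Data.Integer as ℤ using (ℤ; +_; -_)
open import Data.Bool using (Bool; true; false; if_then_else_; _∧_; not)
open import Data.List using (List; []; _∷_; _++_; map; concatMap; upTo; replicate; foldr)
open import Data.Bool.ListAction using (any; all)
open import Data.Product using (_×_; _,_; proj₁; proj₂)

data Color : Set where
  blue green : Color

CPart : Set
CPart = ℕ × Color

isBlue : Color → Bool
isBlue blue  = true
isBlue green = false

evenᵇ : ℕ → Bool
evenᵇ zero          = true
evenᵇ (suc zero)    = false
evenᵇ (suc (suc n)) = evenᵇ n

allParts : ℕ → List CPart
allParts n = concatMap (λ k → (suc k , blue) ∷ (suc k , green) ∷ []) (upTo n)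

-- ptn ps m : all multisets of coloured parts drawn from ps (each of size ≥ 1)
-- with total m, each listed once (multiplicities chosen along ps).
ptn : List CPart → ℕ → List (List CPart)
ptn []       zero    = [] ∷ []
ptn []       (suc _) = []
ptn (p ∷ ps) m = concatMap
  (λ j → if j ℕ.* proj₁ p ≤ᵇ m
           then map (replicate j p ++_) (ptn ps (m ∸ j ℕ.* proj₁ p))
           else [])
  (upTo (suc m))

twoColorPartitions : ℕ → List (List CPart)
twoColorPartitions n = ptn (allParts n) n

countSize : ℕ → List CPart → ℕ
countSize k []            = 0
countSize k ((a , _) ∷ π) = (if a ≡ᵇ k then 1 else 0) ℕ.+ countSize k π

minSize : List CPart → ℕ
minSize []            = 0
minSize ((a , _) ∷ π) = foldr (λ x m → ℕ._⊓_ (proj₁ x) m) a π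

evenPartsBlue : List CPart → Bool
evenPartsBlue = all (λ x → if evenᵇ (proj₁ x) then isBlue (proj₂ x) else true)

evenPartsDistinct : List CPart → Bool
evenPartsDistinct π = all (λ x → if evenᵇ (proj₁ x) then countSize (proj₁ x) π ≤ᵇ 1 else true) π

greenPartsOdd : List CPart → Bool
greenPartsOdd = all (λ x → if isBlue (proj₂ x) then true else not (evenᵇ (proj₁ x)))

smallestOddAndBlue : List CPart → Bool
smallestOddAndBlue []      = false
smallestOddAndBlue π@(_ ∷ _) =
  not (evenᵇ (minSize π)) ∧ any (λ x → (proj₁ x ≡ᵇ minSize π) ∧ isBlue (proj₂ x)) π

admissible : List CPart → Bool
admissible π = evenPartsBlue π ∧ evenPartsDistinct π ∧ greenPartsOdd π ∧ smallestOddAndBlue π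

numEven : List CPart → ℕ
numEven []            = 0
numEven ((a , _) ∷ π) = (if evenᵇ a then 1 else 0) ℕ.+ numEven π

sign : ℕ → ℤ
sign zero    = + 1
sign (suc j) = - sign j

Tω : ℕ → ℤ
Tω n = foldr (λ π acc → (if admissible π then sign (numEven π) else + 0) ℤ.+ acc)
             (+ 0) (twoColorPartitions n)

Series : Set
Series = ℕ → ℤ

Σ≤ : ℕ → (ℕ → ℤ) → ℤ
Σ≤ zero    f = f 0
Σ≤ (suc n) f = Σ≤ n f ℤ.+ f (suc n)

oneˢ : Series
oneˢ zero    = + 1
oneˢ (suc _) = + 0

qpow : ℕ → Series
qpow k n = if n ≡ᵇ k then + 1 else + 0

_-ˢ_ : Series → Series → Series
(f -ˢ g) n = f n ℤ.- g n

_*ˢ_ : Series → Series → Series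
(f *ˢ g) n = Σ≤ n (λ i → f i ℤ.* g (n ∸ i))

-- multiplicative inverse of a series with constant term 1:
-- g₀ = 1, g_n = - Σ_{i=1}^{n} f_i g_{n-i}.
-- invAux f n = [g_n , … , g_0]
private
  conv : Series → List ℤ → ℕ → ℤ
  conv f []       i = + 0
  conv f (r ∷ rs) i = f i ℤ.* r ℤ.+ conv f rs (suc i)

invAux : Series → ℕ → List ℤ
invAux f zero    = + 1 ∷ []
invAux f (suc n) = let rs = invAux f n in (- conv f rs 1) ∷ rs

invˢ : Series → Series
invˢ f n with invAux f n
... | []    = + 0
... | g ∷ _ = g

qPoch : ℕ → ℕ → ℕ → Series
qPoch a b zero    = oneˢ
qPoch a b (suc n) = qPoch a b n *ˢ (oneˢ -ˢ qpow (a ℕ.+ b ℕ.* n))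

ωterm : ℕ → Series
ωterm n = qpow (2 ℕ.* n ℕ.* n ℕ.+ 2 ℕ.* n)
          *ˢ (invˢ (qPoch 1 2 (suc n)) *ˢ invˢ (qPoch 1 2 (suc n)))

-- ω(q) = Σ_{n≥0} ωterm n ; ωterm n has order 2n²+2n ≥ n, so the
-- coefficient of q^m only receives contributions from n ≤ m.
ω : Series
ω m = Σ≤ m (λ n → ωterm n m)

-- Everything is computed modulo q^(N+1), in the commutative ring of truncated
-- series, where the infinite products and sums below become finite.
--
-- Sum the signed weight over the multiplicities of each part size in turn.  If
-- the smallest part is s = 2m+1, the sizes below s are absent, s contributes
-- q^s/(1-q^s)², every larger odd size k contributes 1/(1-q^k)², and every larger
-- even size k contributes 1-q^k (it occurs at most once, in blue, with sign -1).
-- Hence the generating function is Σ_m q^(2m+1) (q^(2m+2);q²)_∞/(q^(2m+1);q²)_∞²,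
-- which is q C(q,q) for p = q² and
--   C(a,b) = Σ_m p^m (p^(m+1);p)_∞ / ((ap^m;p)_∞ (bp^m;p)_∞),
-- while ω(q) = D(q,q) for the Durfee-type sum
--   D(a,b) = Σ_n (ab)^n p^(n²) / ((a;p)_(n+1) (b;p)_(n+1)).
-- (C and D are productSum and durfeeSum below.)  Both C(-,b) and D(-,b) satisfy
-- (1-a) F(a) = 1 + b F(ap).  For b = q the solution is unique: the difference Δ
-- of two solutions has (1-a) Δ(a) = q Δ(ap), so every power of q divides Δ(q).
module Submission where

open import Defs
open import Data.Nat using (ℕ; _≤_)
open import Relation.Binary.PropositionalEquality using (_≡_)

open import Data.Nat as ℕ using (zero; suc; _∸_; _<_; z≤n; s≤s; _≤ᵇ_; _≡ᵇ_)
open import Data.Bool using (Bool; true; false; if_then_else_)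
import Data.Nat.Properties as ℕₚ
open import Data.Integer as ℤ using (ℤ; +_)
import Data.Integer.Properties as ℤₚ
open import Data.List using (List; []; _∷_)
open import Data.Empty using (⊥-elim)
open import Data.Sum using (inj₁; inj₂)
open import Function using (_∘_)
open import Relation.Binary.PropositionalEquality
  using (_≢_; _≗_; refl; sym; trans; cong; cong₂; module ≡-Reasoning)

module Coefficients where

  open import Data.Integer using (_+_; _*_; -_)
  open import Relation.Nullary.Reflects using (ofʸ; ofⁿ)
  open import Algebra.Properties.CommutativeSemigroup ℤₚ.+-commutativeSemigroup
    using () renaming (interchange to +-interchange)
  open ≡-Reasoning

  Σ≤-cong : ∀ n {f g : ℕ → ℤ} → (∀ i → i ≤ n → f i ≡ g i) → Σ≤ n f ≡ Σ≤ n g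
  Σ≤-cong zero    f≡g = f≡g 0 z≤n
  Σ≤-cong (suc n) f≡g =
    cong₂ _+_ (Σ≤-cong n (λ i i≤n → f≡g i (ℕₚ.m≤n⇒m≤1+n i≤n))) (f≡g (suc n) ℕₚ.≤-refl)

  Σ≤-cong′ : ∀ n {f g : ℕ → ℤ} → f ≗ g → Σ≤ n f ≡ Σ≤ n g
  Σ≤-cong′ n f≗g = Σ≤-cong n (λ i _ → f≗g i)

  Σ≤-+ : ∀ n (f g : ℕ → ℤ) → Σ≤ n (λ i → f i + g i) ≡ Σ≤ n f + Σ≤ n g
  Σ≤-+ zero    f g = refl
  Σ≤-+ (suc n) f g =
    trans (cong (_+ (f (suc n) + g (suc n))) (Σ≤-+ n f g)) (+-interchange (Σ≤ n f) (Σ≤ n g) _ _)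

  Σ≤-*ˡ : ∀ n c (f : ℕ → ℤ) → c * Σ≤ n f ≡ Σ≤ n (λ i → c * f i)
  Σ≤-*ˡ zero    c f = refl
  Σ≤-*ˡ (suc n) c f =
    trans (ℤₚ.*-distribˡ-+ c (Σ≤ n f) (f (suc n))) (cong (_+ c * f (suc n)) (Σ≤-*ˡ n c f))

  Σ≤-*ʳ : ∀ n c (f : ℕ → ℤ) → Σ≤ n f * c ≡ Σ≤ n (λ i → f i * c)
  Σ≤-*ʳ n c f = begin
    Σ≤ n f * c               ≡⟨ ℤₚ.*-comm (Σ≤ n f) c ⟩
    c * Σ≤ n f               ≡⟨ Σ≤-*ˡ n c f ⟩
    Σ≤ n (λ i → c * f i)     ≡⟨ Σ≤-cong′ n (λ i → ℤₚ.*-comm c (f i)) ⟩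
    Σ≤ n (λ i → f i * c)     ∎

  Σ≤-zero : ∀ n {f : ℕ → ℤ} → (∀ i → f i ≡ + 0) → Σ≤ n f ≡ + 0
  Σ≤-zero zero    f≡0 = f≡0 0
  Σ≤-zero (suc n) f≡0 = cong₂ _+_ (Σ≤-zero n f≡0) (f≡0 (suc n))

  Σ≤-front : ∀ n (f : ℕ → ℤ) → Σ≤ (suc n) f ≡ f 0 + Σ≤ n (f ∘ suc)
  Σ≤-front zero    f = refl
  Σ≤-front (suc n) f = trans (cong (_+ f (suc (suc n))) (Σ≤-front n f)) (ℤₚ.+-assoc (f 0) _ _)

  Σ≤-reverse : ∀ n (f : ℕ → ℤ) → Σ≤ n f ≡ Σ≤ n (λ i → f (n ∸ i))
  Σ≤-reverse zero    f = refl
  Σ≤-reverse (suc n) f = begin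
    Σ≤ n f + f (suc n)                            ≡⟨ cong (_+ f (suc n)) (Σ≤-reverse n f) ⟩
    Σ≤ n (λ i → f (n ∸ i)) + f (suc n)            ≡⟨ ℤₚ.+-comm _ (f (suc n)) ⟩
    f (suc n) + Σ≤ n (λ i → f (n ∸ i))            ≡⟨ Σ≤-front n (λ i → f (suc n ∸ i)) ⟨
    Σ≤ (suc n) (λ i → f (suc n ∸ i))              ∎

  Σ≤-triangle : ∀ n (F : ℕ → ℕ → ℤ) →
    Σ≤ n (λ i → Σ≤ i (F i)) ≡ Σ≤ n (λ j → Σ≤ (n ∸ j) (λ k → F (j ℕ.+ k) j))
  Σ≤-triangle zero    F = refl
  Σ≤-triangle (suc n) F = begin
    Σ≤ (suc n) (λ i → Σ≤ i (F i))
      ≡⟨ Σ≤-front n _ ⟩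
    F 0 0 + Σ≤ n (λ i → Σ≤ (suc i) (F (suc i)))
      ≡⟨ cong (λ x → F 0 0 + x) (Σ≤-cong′ n (λ i → Σ≤-front i (F (suc i)))) ⟩
    F 0 0 + Σ≤ n (λ i → F (suc i) 0 + Σ≤ i (F (suc i) ∘ suc))
      ≡⟨ cong (λ x → F 0 0 + x) (Σ≤-+ n _ _) ⟩
    F 0 0 + (Σ≤ n (λ i → F (suc i) 0) + Σ≤ n (λ i → Σ≤ i (F (suc i) ∘ suc)))
      ≡⟨ cong (λ x → F 0 0 + (Σ≤ n (λ i → F (suc i) 0) + x)) (Σ≤-triangle n (λ i j → F (suc i) (suc j))) ⟩
    F 0 0 + (Σ≤ n (λ i → F (suc i) 0) + rest)
      ≡⟨ ℤₚ.+-assoc (F 0 0) _ _ ⟨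
    (F 0 0 + Σ≤ n (λ i → F (suc i) 0)) + rest
      ≡⟨ cong (_+ rest) (Σ≤-front n (λ k → F k 0)) ⟨
    Σ≤ (suc n) (λ k → F k 0) + rest
      ≡⟨ Σ≤-front n _ ⟨
    Σ≤ (suc n) (λ j → Σ≤ (suc n ∸ j) (λ k → F (j ℕ.+ k) j))
      ∎
    where rest = Σ≤ n (λ j → Σ≤ (n ∸ j) (λ k → F (suc j ℕ.+ k) (suc j)))

  Σ≤-extend : ∀ K {m} (f : ℕ → ℤ) → m ≤ K → (∀ i → m < i → f i ≡ + 0) → Σ≤ K f ≡ Σ≤ m f
  Σ≤-extend zero    f z≤n _ = refl
  Σ≤-extend (suc K) f m≤1+K f≡0 with ℕₚ.m≤n⇒m<n∨m≡n m≤1+K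
  ... | inj₂ refl = refl
  ... | inj₁ m<1+K =
    trans (cong₂ _+_ (Σ≤-extend K f (ℕₚ.≤-pred m<1+K) f≡0) (f≡0 (suc K) m<1+K)) (ℤₚ.+-identityʳ _)

  infixl 6 _+ˢ_

  _+ˢ_ : Series → Series → Series
  (f +ˢ g) n = f n + g n

  negˢ : Series → Series
  negˢ f n = - f n

  *ˢ-cong : ∀ {f f′ g g′} → f ≗ f′ → g ≗ g′ → f *ˢ g ≗ f′ *ˢ g′
  *ˢ-cong f≗f′ g≗g′ n = Σ≤-cong′ n (λ i → cong₂ _*_ (f≗f′ i) (g≗g′ (n ∸ i)))

  *ˢ-comm : ∀ f g → f *ˢ g ≗ g *ˢ f
  *ˢ-comm f g n = begin
    Σ≤ n (λ i → f i * g (n ∸ i))                ≡⟨ Σ≤-reverse n _ ⟩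
    Σ≤ n (λ i → f (n ∸ i) * g (n ∸ (n ∸ i)))    ≡⟨ Σ≤-cong n swap ⟩
    Σ≤ n (λ i → g i * f (n ∸ i))                ∎
    where
    swap : ∀ i → i ≤ n → f (n ∸ i) * g (n ∸ (n ∸ i)) ≡ g i * f (n ∸ i)
    swap i i≤n = trans (cong (λ j → f (n ∸ i) * g j) (ℕₚ.m∸[m∸n]≡n i≤n)) (ℤₚ.*-comm (f (n ∸ i)) (g i))

  *ˢ-assoc : ∀ f g h → (f *ˢ g) *ˢ h ≗ f *ˢ (g *ˢ h)
  *ˢ-assoc f g h n = begin
    Σ≤ n (λ i → Σ≤ i (λ j → f j * g (i ∸ j)) * h (n ∸ i))
      ≡⟨ Σ≤-cong′ n (λ i → Σ≤-*ʳ i (h (n ∸ i)) _) ⟩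
    Σ≤ n (λ i → Σ≤ i (λ j → f j * g (i ∸ j) * h (n ∸ i)))
      ≡⟨ Σ≤-triangle n (λ i j → f j * g (i ∸ j) * h (n ∸ i)) ⟩
    Σ≤ n (λ j → Σ≤ (n ∸ j) (λ k → f j * g ((j ℕ.+ k) ∸ j) * h (n ∸ (j ℕ.+ k))))
      ≡⟨ Σ≤-cong′ n (λ j → Σ≤-cong′ (n ∸ j) (reindex j)) ⟩
    Σ≤ n (λ j → Σ≤ (n ∸ j) (λ k → f j * (g k * h (n ∸ j ∸ k))))
      ≡⟨ Σ≤-cong′ n (λ j → Σ≤-*ˡ (n ∸ j) (f j) _) ⟨
    Σ≤ n (λ j → f j * Σ≤ (n ∸ j) (λ k → g k * h (n ∸ j ∸ k)))
      ∎
    where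
    reindex : ∀ j k → f j * g ((j ℕ.+ k) ∸ j) * h (n ∸ (j ℕ.+ k)) ≡ f j * (g k * h (n ∸ j ∸ k))
    reindex j k = trans (cong₂ (λ a b → f j * g a * h b) (ℕₚ.m+n∸m≡n j k) (sym (ℕₚ.∸-+-assoc n j k)))
                        (ℤₚ.*-assoc (f j) (g k) (h (n ∸ j ∸ k)))

  *ˢ-distribˡ-+ˢ : ∀ f g h → f *ˢ (g +ˢ h) ≗ f *ˢ g +ˢ f *ˢ h
  *ˢ-distribˡ-+ˢ f g h n =
    trans (Σ≤-cong′ n (λ i → ℤₚ.*-distribˡ-+ (f i) (g (n ∸ i)) (h (n ∸ i)))) (Σ≤-+ n _ _)

  *ˢ-identityˡ : ∀ f → oneˢ *ˢ f ≗ f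
  *ˢ-identityˡ f zero    = ℤₚ.*-identityˡ (f 0)
  *ˢ-identityˡ f (suc n) = begin
    Σ≤ (suc n) (λ i → oneˢ i * f (suc n ∸ i))   ≡⟨ Σ≤-front n _ ⟩
    + 1 * f (suc n) + Σ≤ n (λ _ → + 0)          ≡⟨ cong₂ _+_ (ℤₚ.*-identityˡ (f (suc n))) (Σ≤-zero n (λ _ → refl)) ⟩
    f (suc n) + + 0                             ≡⟨ ℤₚ.+-identityʳ _ ⟩
    f (suc n)                                   ∎

  ≡ᵇ-refl : ∀ k → (k ≡ᵇ k) ≡ true
  ≡ᵇ-refl zero    = refl
  ≡ᵇ-refl (suc k) = ≡ᵇ-refl k

  ≢⇒≡ᵇ-false : ∀ {n k} → n ≢ k → (n ≡ᵇ k) ≡ false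
  ≢⇒≡ᵇ-false {zero}  {zero}  n≢k = ⊥-elim (n≢k refl)
  ≢⇒≡ᵇ-false {zero}  {suc k} _   = refl
  ≢⇒≡ᵇ-false {suc n} {zero}  _   = refl
  ≢⇒≡ᵇ-false {suc n} {suc k} n≢k = ≢⇒≡ᵇ-false (n≢k ∘ cong suc)

  qpow-≡ : ∀ k → qpow k k ≡ + 1
  qpow-≡ k = cong (λ b → if b then + 1 else + 0) (≡ᵇ-refl k)

  qpow-≢ : ∀ {k n} → n ≢ k → qpow k n ≡ + 0
  qpow-≢ n≢k = cong (λ b → if b then + 1 else + 0) (≢⇒≡ᵇ-false n≢k)

  Σ≤-qpow-< : ∀ n k (g : ℕ → ℤ) → n < k → Σ≤ n (λ i → qpow k i * g i) ≡ + 0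
  Σ≤-qpow-< n k g n<k = trans (Σ≤-cong n {g = λ _ → + 0} vanish) (Σ≤-zero n (λ _ → refl))
    where
    vanish : ∀ i → i ≤ n → qpow k i * g i ≡ + 0
    vanish i i≤n = cong (_* g i) (qpow-≢ (ℕₚ.<⇒≢ (ℕₚ.≤-<-trans i≤n n<k)))

  Σ≤-qpow-≥ : ∀ n k (g : ℕ → ℤ) → k ≤ n → Σ≤ n (λ i → qpow k i * g i) ≡ g k
  Σ≤-qpow-≥ zero    zero g z≤n = ℤₚ.*-identityˡ (g 0)
  Σ≤-qpow-≥ (suc n) k  g k≤1+n with ℕₚ.m≤n⇒m<n∨m≡n k≤1+n
  ... | inj₁ k<1+n = begin
    Σ≤ n (λ i → qpow k i * g i) + qpow k (suc n) * g (suc n)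
      ≡⟨ cong₂ _+_ (Σ≤-qpow-≥ n k g (ℕₚ.≤-pred k<1+n)) (cong (_* g (suc n)) (qpow-≢ (ℕₚ.>⇒≢ k<1+n))) ⟩
    g k + + 0
      ≡⟨ ℤₚ.+-identityʳ (g k) ⟩
    g k ∎
  ... | inj₂ refl = begin
    Σ≤ n (λ i → qpow (suc n) i * g i) + qpow (suc n) (suc n) * g (suc n)
      ≡⟨ cong₂ _+_ (Σ≤-qpow-< n (suc n) g ℕₚ.≤-refl) (cong (_* g (suc n)) (qpow-≡ (suc n))) ⟩
    + 0 + + 1 * g (suc n)
      ≡⟨ trans (ℤₚ.+-identityˡ _) (ℤₚ.*-identityˡ (g (suc n))) ⟩
    g (suc n) ∎

  qpow-*ˢ-< : ∀ k f {n} → n < k → (qpow k *ˢ f) n ≡ + 0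
  qpow-*ˢ-< k f {n} = Σ≤-qpow-< n k (λ i → f (n ∸ i))

  qpow-*ˢ-≥ : ∀ k f {n} → k ≤ n → (qpow k *ˢ f) n ≡ f (n ∸ k)
  qpow-*ˢ-≥ k f {n} = Σ≤-qpow-≥ n k (λ i → f (n ∸ i))

  qpow-*ˢ-≤ᵇ : ∀ k f n → (qpow k *ˢ f) n ≡ (if k ≤ᵇ n then f (n ∸ k) else + 0)
  qpow-*ˢ-≤ᵇ k f n with k ≤ᵇ n | ℕₚ.≤ᵇ-reflects-≤ k n
  ... | true  | ofʸ k≤n = Σ≤-qpow-≥ n k (λ i → f (n ∸ i)) k≤n
  ... | false | ofⁿ k≰n = Σ≤-qpow-< n k (λ i → f (n ∸ i)) (ℕₚ.≰⇒> k≰n)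

  -- `Defs` keeps the convolution used by `invAux` private.  Abstracting over
  -- `invAux f n` and `1` below leaves the pattern problem
  -- `convolution f rs k = conv f rs k`, which fills the hole with it.
  mutual
    convolution : Series → List ℤ → ℕ → ℤ
    convolution = _

    invˢ-suc : ∀ f n → invˢ f (suc n) ≡ - convolution f (invAux f n) 1
    invˢ-suc f n with invAux f n | 1
    ... | rs | k = refl

  convolution-invAux : ∀ f n k → convolution f (invAux f n) k ≡ Σ≤ n (λ i → f (k ℕ.+ i) * invˢ f (n ∸ i))
  convolution-invAux f zero    k = trans (ℤₚ.+-identityʳ _) (cong (λ j → f j * + 1) (sym (ℕₚ.+-identityʳ k)))
  convolution-invAux f (suc n) k = begin
    f k * invˢ f (suc n) + convolution f (invAux f n) (suc k)
      ≡⟨ cong₂ _+_ (cong (λ j → f j * invˢ f (suc n)) (sym (ℕₚ.+-identityʳ k))) (convolution-invAux f n (suc k)) ⟩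
    f (k ℕ.+ 0) * invˢ f (suc n) + Σ≤ n (λ i → f (suc k ℕ.+ i) * invˢ f (n ∸ i))
      ≡⟨ cong (λ x → f (k ℕ.+ 0) * invˢ f (suc n) + x)
              (Σ≤-cong′ n (λ i → cong (λ j → f j * invˢ f (n ∸ i)) (sym (ℕₚ.+-suc k i)))) ⟩
    f (k ℕ.+ 0) * invˢ f (suc n) + Σ≤ n (λ i → f (k ℕ.+ suc i) * invˢ f (n ∸ i))
      ≡⟨ Σ≤-front n (λ i → f (k ℕ.+ i) * invˢ f (suc n ∸ i)) ⟨
    Σ≤ (suc n) (λ i → f (k ℕ.+ i) * invˢ f (suc n ∸ i))
      ∎

  *ˢ-invˢ : ∀ f → f 0 ≡ + 1 → f *ˢ invˢ f ≗ oneˢ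
  *ˢ-invˢ f f₀≡1 zero    = cong (_* + 1) f₀≡1
  *ˢ-invˢ f f₀≡1 (suc n) = begin
    Σ≤ (suc n) (λ i → f i * invˢ f (suc n ∸ i))
      ≡⟨ Σ≤-front n _ ⟩
    f 0 * invˢ f (suc n) + Σ≤ n (λ i → f (suc i) * invˢ f (n ∸ i))
      ≡⟨ cong₂ _+_ (trans (cong (_* invˢ f (suc n)) f₀≡1) (trans (ℤₚ.*-identityˡ _) (invˢ-suc f n)))
                   (sym (convolution-invAux f n 1)) ⟩
    - convolution f (invAux f n) 1 + convolution f (invAux f n) 1
      ≡⟨ ℤₚ.+-inverseˡ (convolution f (invAux f n) 1) ⟩
    + 0 ∎

module Truncated (N : ℕ) where

  open Coefficients
  open import Level using (0ℓ)
  open import Data.Maybe using (Maybe; just; nothing)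
  open import Data.Product using (_,_)
  open import Relation.Nullary using (yes; no)
  open import Algebra.Bundles using (CommutativeRing)
  open import Relation.Binary.Structures using (IsEquivalence)
  import Algebra.Solver.Ring.AlmostCommutativeRing as ACR
  import Algebra.Solver.Ring
  import Relation.Binary.Reasoning.Setoid

  infix 4 _≈_

  _≈_ : Series → Series → Set
  f ≈ g = ∀ n → n ≤ N → f n ≡ g n

  constˢ : ℤ → Series
  constˢ c zero    = c
  constˢ c (suc n) = + 0

  constˢ-0 : constˢ (+ 0) ≗ (λ _ → + 0)
  constˢ-0 zero    = refl
  constˢ-0 (suc n) = refl

  constˢ-1 : constˢ (+ 1) ≗ oneˢ
  constˢ-1 zero    = refl
  constˢ-1 (suc n) = refl

  -- Opaque, so that checking the ring-solver proofs does not unfold Cauchy products.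
  opaque
    infixl 6 _⊕_
    infixl 7 _⊛_
    infix  8 ⊝_

    _⊕_ : Series → Series → Series
    _⊕_ = _+ˢ_

    _⊛_ : Series → Series → Series
    _⊛_ = _*ˢ_

    ⊝_ : Series → Series
    ⊝_ = negˢ

  opaque
    unfolding _⊕_ _⊛_ ⊝_

    ⊕-def : ∀ f g n → (f ⊕ g) n ≡ f n ℤ.+ g n
    ⊕-def f g n = refl

    ⊛-def : ∀ f g n → (f ⊛ g) n ≡ (f *ˢ g) n
    ⊛-def f g n = refl

    ⊝-def : ∀ f n → (⊝ f) n ≡ ℤ.- f n
    ⊝-def f n = refl

  private
    ⊛-≗ : ∀ {f g f′ g′} → f *ˢ g ≗ f′ *ˢ g′ → f ⊛ g ≈ f′ ⊛ g′
    ⊛-≗ {f} {g} {f′} {g′} e n _ = trans (⊛-def f g n) (trans (e n) (sym (⊛-def f′ g′ n)))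

    ⊕-pointwise : ∀ {f g h} → (∀ n → f n ℤ.+ g n ≡ h n) → f ⊕ g ≈ h
    ⊕-pointwise {f} {g} e n _ = trans (⊕-def f g n) (e n)

    ≈-isEquivalence : IsEquivalence _≈_
    ≈-isEquivalence = record
      { refl  = λ _ _ → refl
      ; sym   = λ e n n≤N → sym (e n n≤N)
      ; trans = λ e e′ n n≤N → trans (e n n≤N) (e′ n n≤N)
      }

    ⊕-cong : ∀ {f f′ g g′} → f ≈ f′ → g ≈ g′ → f ⊕ g ≈ f′ ⊕ g′
    ⊕-cong {f} {f′} {g} {g′} e e′ n n≤N =
      trans (⊕-def f g n) (trans (cong₂ ℤ._+_ (e n n≤N) (e′ n n≤N)) (sym (⊕-def f′ g′ n)))

    ⊝-cong : ∀ {f f′} → f ≈ f′ → ⊝ f ≈ ⊝ f′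
    ⊝-cong {f} {f′} e n n≤N = trans (⊝-def f n) (trans (cong ℤ.-_ (e n n≤N)) (sym (⊝-def f′ n)))

    ⊛-cong : ∀ {f f′ g g′} → f ≈ f′ → g ≈ g′ → f ⊛ g ≈ f′ ⊛ g′
    ⊛-cong {f} {f′} {g} {g′} e e′ n n≤N =
      trans (⊛-def f g n) (trans (Σ≤-cong n coefficient) (sym (⊛-def f′ g′ n)))
      where
      coefficient : ∀ i → i ≤ n → f i ℤ.* g (n ∸ i) ≡ f′ i ℤ.* g′ (n ∸ i)
      coefficient i i≤n =
        cong₂ ℤ._*_ (e i (ℕₚ.≤-trans i≤n n≤N)) (e′ (n ∸ i) (ℕₚ.≤-trans (ℕₚ.m∸n≤m n i) n≤N))

    ⊕-assoc : ∀ f g h → (f ⊕ g) ⊕ h ≈ f ⊕ (g ⊕ h)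
    ⊕-assoc f g h n _ = begin
      ((f ⊕ g) ⊕ h) n        ≡⟨ trans (⊕-def (f ⊕ g) h n) (cong (ℤ._+ h n) (⊕-def f g n)) ⟩
      f n ℤ.+ g n ℤ.+ h n    ≡⟨ ℤₚ.+-assoc (f n) (g n) (h n) ⟩
      f n ℤ.+ (g n ℤ.+ h n)  ≡⟨ trans (⊕-def f (g ⊕ h) n) (cong (λ x → f n ℤ.+ x) (⊕-def g h n)) ⟨
      (f ⊕ (g ⊕ h)) n        ∎
      where open ≡-Reasoning

    ⊕-comm : ∀ f g → f ⊕ g ≈ g ⊕ f
    ⊕-comm f g n _ = trans (⊕-def f g n) (trans (ℤₚ.+-comm (f n) (g n)) (sym (⊕-def g f n)))

    ⊕-identityˡ : ∀ f → constˢ (+ 0) ⊕ f ≈ f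
    ⊕-identityˡ f = ⊕-pointwise (λ n → trans (cong (ℤ._+ f n) (constˢ-0 n)) (ℤₚ.+-identityˡ (f n)))

    ⊕-identityʳ : ∀ f → f ⊕ constˢ (+ 0) ≈ f
    ⊕-identityʳ f = ⊕-pointwise (λ n → trans (cong (λ x → f n ℤ.+ x) (constˢ-0 n)) (ℤₚ.+-identityʳ (f n)))

    ⊕-inverseˡ : ∀ f → ⊝ f ⊕ f ≈ constˢ (+ 0)
    ⊕-inverseˡ f = ⊕-pointwise (λ n →
      trans (cong (ℤ._+ f n) (⊝-def f n)) (trans (ℤₚ.+-inverseˡ (f n)) (sym (constˢ-0 n))))

    ⊕-inverseʳ : ∀ f → f ⊕ ⊝ f ≈ constˢ (+ 0)
    ⊕-inverseʳ f = ⊕-pointwise (λ n →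
      trans (cong (λ x → f n ℤ.+ x) (⊝-def f n)) (trans (ℤₚ.+-inverseʳ (f n)) (sym (constˢ-0 n))))

    ⊛-comm : ∀ f g → f ⊛ g ≈ g ⊛ f
    ⊛-comm f g = ⊛-≗ (*ˢ-comm f g)

    ⊛-assoc : ∀ f g h → (f ⊛ g) ⊛ h ≈ f ⊛ (g ⊛ h)
    ⊛-assoc f g h n _ = begin
      ((f ⊛ g) ⊛ h) n        ≡⟨ trans (⊛-def (f ⊛ g) h n) (*ˢ-cong {g = h} (⊛-def f g) (λ _ → refl) n) ⟩
      ((f *ˢ g) *ˢ h) n      ≡⟨ *ˢ-assoc f g h n ⟩
      (f *ˢ (g *ˢ h)) n      ≡⟨ trans (⊛-def f (g ⊛ h) n) (*ˢ-cong {f = f} (λ _ → refl) (⊛-def g h) n) ⟨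
      (f ⊛ (g ⊛ h)) n        ∎
      where open ≡-Reasoning

    ⊛-identityˡ : ∀ f → constˢ (+ 1) ⊛ f ≈ f
    ⊛-identityˡ f n _ =
      trans (⊛-def (constˢ (+ 1)) f n) (trans (*ˢ-cong {g = f} constˢ-1 (λ _ → refl) n) (*ˢ-identityˡ f n))

    ⊛-identityʳ : ∀ f → f ⊛ constˢ (+ 1) ≈ f
    ⊛-identityʳ f n n≤N = trans (⊛-comm f (constˢ (+ 1)) n n≤N) (⊛-identityˡ f n n≤N)

    ⊛-distribˡ-⊕ : ∀ f g h → f ⊛ (g ⊕ h) ≈ f ⊛ g ⊕ f ⊛ h
    ⊛-distribˡ-⊕ f g h n _ = begin
      (f ⊛ (g ⊕ h)) n              ≡⟨ trans (⊛-def f (g ⊕ h) n) (*ˢ-cong {f = f} (λ _ → refl) (⊕-def g h) n) ⟩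
      (f *ˢ (g +ˢ h)) n            ≡⟨ *ˢ-distribˡ-+ˢ f g h n ⟩
      (f *ˢ g) n ℤ.+ (f *ˢ h) n    ≡⟨ trans (⊕-def (f ⊛ g) (f ⊛ h) n) (cong₂ ℤ._+_ (⊛-def f g n) (⊛-def f h n)) ⟨
      (f ⊛ g ⊕ f ⊛ h) n            ∎
      where open ≡-Reasoning

    ⊛-distribʳ-⊕ : ∀ f g h → (g ⊕ h) ⊛ f ≈ g ⊛ f ⊕ h ⊛ f
    ⊛-distribʳ-⊕ f g h n n≤N = begin
      ((g ⊕ h) ⊛ f) n       ≡⟨ ⊛-comm (g ⊕ h) f n n≤N ⟩
      (f ⊛ (g ⊕ h)) n       ≡⟨ ⊛-distribˡ-⊕ f g h n n≤N ⟩
      (f ⊛ g ⊕ f ⊛ h) n     ≡⟨ ⊕-cong (⊛-comm f g) (⊛-comm f h) n n≤N ⟩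
      (g ⊛ f ⊕ h ⊛ f) n     ∎
      where open ≡-Reasoning

  seriesRing : CommutativeRing 0ℓ 0ℓ
  seriesRing = record
    { Carrier = Series
    ; _≈_ = _≈_
    ; _+_ = _⊕_
    ; _*_ = _⊛_
    ; -_ = ⊝_
    ; 0# = constˢ (+ 0)
    ; 1# = constˢ (+ 1)
    ; isCommutativeRing = record
      { isRing = record
        { +-isAbelianGroup = record
          { isGroup = record
            { isMonoid = record
              { isSemigroup = record
                { isMagma = record { isEquivalence = ≈-isEquivalence ; ∙-cong = ⊕-cong }
                ; assoc = ⊕-assoc }
              ; identity = ⊕-identityˡ , ⊕-identityʳ }
            ; inverse = ⊕-inverseˡ , ⊕-inverseʳ
            ; ⁻¹-cong = ⊝-cong }
          ; comm = ⊕-comm }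
        ; *-cong = ⊛-cong
        ; *-assoc = ⊛-assoc
        ; *-identity = ⊛-identityˡ , ⊛-identityʳ
        ; distrib = ⊛-distribˡ-⊕ , ⊛-distribʳ-⊕ }
      ; *-comm = ⊛-comm } }

  open CommutativeRing seriesRing public
    hiding (_≈_) renaming (refl to ≈-refl; sym to ≈-sym; trans to ≈-trans; reflexive to ≈-reflexive)
  open import Algebra.Properties.CommutativeSemiring.Exp commutativeSemiring public
    using (_^_; ^-congˡ; ^-homo-*; ^-distrib-*)
  open Relation.Binary.Reasoning.Setoid setoid public

  private
    constˢ-homo-* : ∀ a b → constˢ (a ℤ.* b) ≈ constˢ a ⊛ constˢ b
    constˢ-homo-* a b zero    _ = sym (⊛-def (constˢ a) (constˢ b) 0)
    constˢ-homo-* a b (suc n) _ = sym (trans (⊛-def (constˢ a) (constˢ b) (suc n)) (trans (Σ≤-front n _)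
      (cong₂ ℤ._+_ (ℤₚ.*-zeroʳ a) (Σ≤-zero n (λ _ → refl)))))

    constˢ-homo : ℤ.+-*-rawRing ACR.-Raw-AlmostCommutative⟶ ACR.fromCommutativeRing seriesRing
    constˢ-homo = record
      { ⟦_⟧    = constˢ
      ; +-homo = λ a b → λ { zero _ → sym (⊕-def (constˢ a) (constˢ b) 0)
                           ; (suc n) _ → sym (⊕-def (constˢ a) (constˢ b) (suc n)) }
      ; *-homo = constˢ-homo-*
      ; -‿homo = λ a → λ { zero _ → sym (⊝-def (constˢ a) 0) ; (suc n) _ → sym (⊝-def (constˢ a) (suc n)) }
      ; 0-homo = λ { zero _ → refl ; (suc n) _ → refl }
      ; 1-homo = λ { zero _ → refl ; (suc n) _ → refl } }

    constˢ-≟ : ∀ a b → Maybe (constˢ a ≈ constˢ b)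
    constˢ-≟ a b with a ℤₚ.≟ b
    ... | yes refl = just ≈-refl
    ... | no _     = nothing

  module Solver = Algebra.Solver.Ring ℤ.+-*-rawRing (ACR.fromCommutativeRing seriesRing) constˢ-homo constˢ-≟

  :0 :1 : ∀ {n} → Solver.Polynomial n
  :0 = Solver.con (+ 0)
  :1 = Solver.con (+ 1)

  *ˢ≈* : ∀ f g → f *ˢ g ≈ f * g
  *ˢ≈* f g n _ = sym (⊛-def f g n)

  -ˢ≈- : ∀ f g → f -ˢ g ≈ f - g
  -ˢ≈- f g n _ = sym (trans (⊕-def f (- g) n) (cong (λ x → f n ℤ.+ x) (⊝-def g n)))

  oneˢ≈1# : oneˢ ≈ 1#
  oneˢ≈1# n _ = sym (constˢ-1 n)

  constˢ-*-coefficient : ∀ c f n → (constˢ c * f) n ≡ c ℤ.* f n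
  constˢ-*-coefficient c f zero    = ⊛-def (constˢ c) f 0
  constˢ-*-coefficient c f (suc n) = trans (⊛-def (constˢ c) f (suc n))
    (trans (Σ≤-front n _) (trans (cong (λ x → c ℤ.* f (suc n) ℤ.+ x) (Σ≤-zero n (λ _ → refl))) (ℤₚ.+-identityʳ _)))

  open Solver using (solve; _:+_; _:*_; _:-_; _:=_)

  Unit : Series → Set
  Unit f = f 0 ≡ + 1

  NoConstant : Series → Set
  NoConstant f = f 0 ≡ + 0

  Unit-* : ∀ {f g} → Unit f → Unit g → Unit (f * g)
  Unit-* {f} {g} f₀≡1 g₀≡1 = trans (⊛-def f g 0) (cong₂ ℤ._*_ f₀≡1 g₀≡1)

  Unit-1- : ∀ {x} → NoConstant x → Unit (1# - x)
  Unit-1- {x} x₀≡0 =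
    trans (⊕-def 1# (- x) 0) (cong (λ t → + 1 ℤ.+ t) (trans (⊝-def x 0) (cong ℤ.-_ x₀≡0)))

  NoConstant-*ˡ : ∀ {x} y → NoConstant x → NoConstant (x * y)
  NoConstant-*ˡ {x} y x₀≡0 = trans (⊛-def x y 0) (cong (ℤ._* y 0) x₀≡0)

  invˢ-inverseʳ : ∀ {f} → Unit f → f * invˢ f ≈ 1#
  invˢ-inverseʳ {f} f₀≡1 n _ = trans (⊛-def f (invˢ f) n) (trans (*ˢ-invˢ f f₀≡1 n) (sym (constˢ-1 n)))

  invˢ-inverseˡ : ∀ {f} → Unit f → invˢ f * f ≈ 1#
  invˢ-inverseˡ {f} f₀≡1 = ≈-trans (*-comm (invˢ f) f) (invˢ-inverseʳ f₀≡1)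

  invˢ-unique : ∀ {x} y → Unit x → y * x ≈ 1# → y ≈ invˢ x
  invˢ-unique {x} y x₀≡1 yx≈1 = begin
    y                  ≈⟨ *-identityʳ y ⟨
    y * 1#             ≈⟨ *-congˡ (invˢ-inverseʳ x₀≡1) ⟨
    y * (x * invˢ x)   ≈⟨ *-assoc y x (invˢ x) ⟨
    y * x * invˢ x     ≈⟨ *-congʳ yx≈1 ⟩
    1# * invˢ x        ≈⟨ *-identityˡ (invˢ x) ⟩
    invˢ x             ∎

  invˢ-cong : ∀ {f g} → Unit f → f ≈ g → invˢ f ≈ invˢ g
  invˢ-cong {f} f₀≡1 f≈g = invˢ-unique (invˢ f) (trans (sym (f≈g 0 z≤n)) f₀≡1)
                                       (≈-trans (*-congˡ (≈-sym f≈g)) (invˢ-inverseˡ f₀≡1))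

  invˢ-1 : invˢ 1# ≈ 1#
  invˢ-1 = ≈-sym (invˢ-unique 1# refl (*-identityˡ 1#))

  invˢ-factor : ∀ {x y} z → Unit x → Unit y → x ≈ y * z → invˢ y ≈ z * invˢ x
  invˢ-factor {x} {y} z x₀≡1 y₀≡1 x≈yz = ≈-sym (invˢ-unique (z * invˢ x) y₀≡1 (begin
    z * invˢ x * y     ≈⟨ reorder z (invˢ x) y ⟩
    invˢ x * (y * z)   ≈⟨ *-congˡ x≈yz ⟨
    invˢ x * x         ≈⟨ invˢ-inverseˡ x₀≡1 ⟩
    1#                 ∎))
    where
    reorder : ∀ a b c → a * b * c ≈ b * (c * a)
    reorder = solve 3 (λ a b c → a :* b :* c := b :* (c :* a)) ≈-refl

  invˢ-* : ∀ {x y} → Unit x → Unit y → invˢ (x * y) ≈ invˢ x * invˢ y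
  invˢ-* {x} {y} x₀≡1 y₀≡1 = ≈-sym (invˢ-unique (invˢ x * invˢ y) (Unit-* {x} {y} x₀≡1 y₀≡1) (begin
    invˢ x * invˢ y * (x * y)      ≈⟨ reorder (invˢ x) (invˢ y) x y ⟩
    (invˢ x * x) * (invˢ y * y)    ≈⟨ *-cong (invˢ-inverseˡ x₀≡1) (invˢ-inverseˡ y₀≡1) ⟩
    1# * 1#                        ≈⟨ *-identityˡ 1# ⟩
    1#                             ∎))
    where
    reorder : ∀ a b c d → a * b * (c * d) ≈ (a * c) * (b * d)
    reorder = solve 4 (λ a b c d → a :* b :* (c :* d) := (a :* c) :* (b :* d)) ≈-refl

  qpow-+ : ∀ a b → qpow a * qpow b ≈ qpow (a ℕ.+ b)
  qpow-+ a b n _ = trans (⊛-def (qpow a) (qpow b) n) (coefficient n)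
    where
    n∸a≡b⇒n≡a+b : ∀ {n} → a ≤ n → n ∸ a ≡ b → n ≡ a ℕ.+ b
    n∸a≡b⇒n≡a+b a≤n n∸a≡b = trans (sym (ℕₚ.m+[n∸m]≡n a≤n)) (cong (a ℕ.+_) n∸a≡b)

    coefficient : ∀ n → (qpow a *ˢ qpow b) n ≡ qpow (a ℕ.+ b) n
    coefficient n with n ℕ.≟ a ℕ.+ b
    ... | yes refl = trans (qpow-*ˢ-≥ a (qpow b) (ℕₚ.m≤m+n a b))
      (trans (cong (qpow b) (ℕₚ.m+n∸m≡n a b)) (trans (qpow-≡ b) (sym (qpow-≡ (a ℕ.+ b)))))
    ... | no n≢a+b with a ℕ.≤? n
    ...   | yes a≤n = trans (qpow-*ˢ-≥ a (qpow b) a≤n)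
                            (trans (qpow-≢ (n≢a+b ∘ n∸a≡b⇒n≡a+b a≤n)) (sym (qpow-≢ n≢a+b)))
    ...   | no  a≰n = trans (qpow-*ˢ-< a (qpow b) (ℕₚ.≰⇒> a≰n)) (sym (qpow-≢ n≢a+b))


  qpow-0 : qpow 0 ≈ 1#
  qpow-0 zero    _ = refl
  qpow-0 (suc n) _ = refl

  qpow-vanish : ∀ {k} → N < k → qpow k ≈ 0#
  qpow-vanish N<k n n≤N = trans (qpow-≢ (ℕₚ.<⇒≢ (ℕₚ.≤-<-trans n≤N N<k))) (sym (constˢ-0 n))

  qpow-^ : ∀ a n → qpow a ^ n ≈ qpow (n ℕ.* a)
  qpow-^ a zero    = ≈-sym qpow-0
  qpow-^ a (suc n) = ≈-trans (*-congˡ (qpow-^ a n)) (qpow-+ a (n ℕ.* a))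

  Σ≤ˢ : ℕ → (ℕ → Series) → Series
  Σ≤ˢ K g n = Σ≤ K (λ m → g m n)

  syntax Σ≤ˢ K (λ m → e) = ∑[ m ≤ K ] e

  Σ≤ˢ-cong : ∀ K {g h : ℕ → Series} → (∀ m → g m ≈ h m) → Σ≤ˢ K g ≈ Σ≤ˢ K h
  Σ≤ˢ-cong K g≈h n n≤N = Σ≤-cong′ K (λ m → g≈h m n n≤N)

  Σ≤ˢ-suc : ∀ K (g : ℕ → Series) → Σ≤ˢ (suc K) g ≈ Σ≤ˢ K g + g (suc K)
  Σ≤ˢ-suc K g n _ = sym (⊕-def (Σ≤ˢ K g) (g (suc K)) n)

  Σ≤ˢ-front : ∀ K (g : ℕ → Series) → Σ≤ˢ (suc K) g ≈ g 0 + Σ≤ˢ K (g ∘ suc)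
  Σ≤ˢ-front K g n _ = trans (Σ≤-front K (λ m → g m n)) (sym (⊕-def (g 0) (Σ≤ˢ K (g ∘ suc)) n))

  Σ≤ˢ-*ˡ : ∀ K c (g : ℕ → Series) → c * Σ≤ˢ K g ≈ ∑[ m ≤ K ] (c * g m)
  Σ≤ˢ-*ˡ zero    c g = *-congˡ {c} ≈-refl
  Σ≤ˢ-*ˡ (suc K) c g = begin
    c * Σ≤ˢ (suc K) g                      ≈⟨ *-congˡ (Σ≤ˢ-suc K g) ⟩
    c * (Σ≤ˢ K g + g (suc K))              ≈⟨ distribˡ c _ _ ⟩
    c * Σ≤ˢ K g + c * g (suc K)            ≈⟨ +-congʳ (Σ≤ˢ-*ˡ K c g) ⟩
    ∑[ m ≤ K ] (c * g m) + c * g (suc K)   ≈⟨ Σ≤ˢ-suc K (λ m → c * g m) ⟨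
    ∑[ m ≤ suc K ] (c * g m)               ∎

  Σ≤ˢ-- : ∀ K (g h : ℕ → Series) → ∑[ m ≤ K ] (g m - h m) ≈ Σ≤ˢ K g - Σ≤ˢ K h
  Σ≤ˢ-- zero    g h = ≈-refl
  Σ≤ˢ-- (suc K) g h = begin
    ∑[ m ≤ suc K ] (g m - h m)                              ≈⟨ Σ≤ˢ-suc K _ ⟩
    ∑[ m ≤ K ] (g m - h m) + (g (suc K) - h (suc K))        ≈⟨ +-congʳ (Σ≤ˢ-- K g h) ⟩
    (Σ≤ˢ K g - Σ≤ˢ K h) + (g (suc K) - h (suc K))           ≈⟨ interchange _ _ _ _ ⟩
    (Σ≤ˢ K g + g (suc K)) - (Σ≤ˢ K h + h (suc K))           ≈⟨ +-cong (Σ≤ˢ-suc K g) (-‿cong (Σ≤ˢ-suc K h)) ⟨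
    Σ≤ˢ (suc K) g - Σ≤ˢ (suc K) h                           ∎
    where
    interchange : ∀ a b c d → (a - b) + (c - d) ≈ (a + c) - (b + d)
    interchange = solve 4 (λ a b c d → (a :- b) :+ (c :- d) := (a :+ c) :- (b :+ d)) ≈-refl

  Σ≤ˢ-zero : ∀ K {g : ℕ → Series} → (∀ m → g m ≈ 0#) → Σ≤ˢ K g ≈ 0#
  Σ≤ˢ-zero K g≈0 n n≤N = trans (Σ≤-zero K (λ m → trans (g≈0 m n n≤N) (constˢ-0 n))) (sym (constˢ-0 n))

  Σ≤ˢ-telescope : ∀ K (h : ℕ → Series) → ∑[ m ≤ K ] (h (suc m) - h m) ≈ h (suc K) - h 0
  Σ≤ˢ-telescope zero    h = ≈-refl
  Σ≤ˢ-telescope (suc K) h = begin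
    ∑[ m ≤ suc K ] (h (suc m) - h m)                             ≈⟨ Σ≤ˢ-suc K _ ⟩
    ∑[ m ≤ K ] (h (suc m) - h m) + (h (suc (suc K)) - h (suc K)) ≈⟨ +-congʳ (Σ≤ˢ-telescope K h) ⟩
    (h (suc K) - h 0) + (h (suc (suc K)) - h (suc K))            ≈⟨ cancel (h (suc K)) (h 0) (h (suc (suc K))) ⟩
    h (suc (suc K)) - h 0                                        ∎
    where
    cancel : ∀ a b c → (a - b) + (c - a) ≈ c - b
    cancel = solve 3 (λ a b c → (a :- b) :+ (c :- a) := c :- b) ≈-refl

  Σ≤ˢ-unfold : ∀ K (f g : ℕ → Series) → (∀ m → f m ≈ g m + f (suc m)) → f 0 ≈ Σ≤ˢ K g + f (suc K)
  Σ≤ˢ-unfold zero    f g step = step 0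
  Σ≤ˢ-unfold (suc K) f g step = begin
    f 0                                         ≈⟨ Σ≤ˢ-unfold K f g step ⟩
    Σ≤ˢ K g + f (suc K)                         ≈⟨ +-congˡ (step (suc K)) ⟩
    Σ≤ˢ K g + (g (suc K) + f (suc (suc K)))     ≈⟨ +-assoc _ _ _ ⟨
    Σ≤ˢ K g + g (suc K) + f (suc (suc K))       ≈⟨ +-congʳ (Σ≤ˢ-suc K g) ⟨
    Σ≤ˢ (suc K) g + f (suc (suc K))             ∎

  ≈-by-downward-recursion : ∀ (c f g : ℕ → Series) →
    (∀ m → f m ≈ c m * f (suc m)) → (∀ m → g m ≈ c m * g (suc m)) →
    (∀ m → N ≤ m → f m ≈ g m) → ∀ m → f m ≈ g m
  ≈-by-downward-recursion c f g f-rec g-rec f≈g-beyond m = go N m (ℕₚ.m≤m+n N m)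
    where
    go : ∀ d m → N ≤ d ℕ.+ m → f m ≈ g m
    go zero    m N≤m    = f≈g-beyond m N≤m
    go (suc d) m N≤d+1+m = begin
      f m               ≈⟨ f-rec m ⟩
      c m * f (suc m)   ≈⟨ *-congˡ (go d (suc m) (ℕₚ.≤-trans N≤d+1+m (ℕₚ.≤-reflexive (sym (ℕₚ.+-suc d m))))) ⟩
      c m * g (suc m)   ≈⟨ g-rec m ⟨
      g m               ∎

module BasicHypergeometric (N : ℕ) where

  open Coefficients
  open Truncated N
  open Solver using (solve; _:+_; _:*_; _:-_; _:=_)

  q p : Series
  q = qpow 1
  p = qpow 2

  p^-vanish : ∀ {k} → N < k → p ^ k ≈ 0#
  p^-vanish {k} N<k = ≈-trans (qpow-^ 2 k) (qpow-vanish (ℕₚ.<-≤-trans N<k (ℕₚ.m≤m*n k 2)))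

  p^N+1-vanish : p ^ suc N ≈ 0#
  p^N+1-vanish = p^-vanish ℕₚ.≤-refl

  NoConstant-*p^ : ∀ {x} m → NoConstant x → NoConstant (x * p ^ m)
  NoConstant-*p^ m = NoConstant-*ˡ (p ^ m)

  poch : Series → ℕ → Series
  poch x zero    = 1#
  poch x (suc n) = poch x n * (1# - x * p ^ n)

  Unit-poch : ∀ {x} n → NoConstant x → Unit (poch x n)
  Unit-poch     zero    _    = refl
  Unit-poch {x} (suc n) x₀≡0 = Unit-* {poch x n} (Unit-poch n x₀≡0) (Unit-1- (NoConstant-*p^ n x₀≡0))

  poch-cong : ∀ {x y} n → x ≈ y → poch x n ≈ poch y n
  poch-cong zero    x≈y = ≈-refl
  poch-cong (suc n) x≈y = *-cong (poch-cong n x≈y) (+-congˡ (-‿cong (*-congʳ x≈y)))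

  poch-shift : ∀ x n → poch x (suc n) ≈ (1# - x) * poch (x * p) n
  poch-shift x zero    = solve 1 (λ x → :1 :* (:1 :- x :* :1) := (:1 :- x) :* :1) ≈-refl x
  poch-shift x (suc n) = begin
    poch x (suc n) * (1# - x * (p * p ^ n))             ≈⟨ *-congʳ (poch-shift x n) ⟩
    (1# - x) * poch (x * p) n * (1# - x * (p * p ^ n))  ≈⟨ reorder x (poch (x * p) n) p (p ^ n) ⟩
    (1# - x) * (poch (x * p) n * (1# - x * p * p ^ n))  ∎
    where
    reorder : ∀ x A p X → (1# - x) * A * (1# - x * (p * X)) ≈ (1# - x) * (A * (1# - x * p * X))
    reorder = solve 4 (λ x A p X → (:1 :- x) :* A :* (:1 :- x :* (p :* X))
                                   := (:1 :- x) :* (A :* (:1 :- x :* p :* X))) ≈-refl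

  poch-0 : ∀ n → poch 0# n ≈ 1#
  poch-0 zero    = ≈-refl
  poch-0 (suc n) = begin
    poch 0# n * (1# - 0# * p ^ n)   ≈⟨ *-congʳ (poch-0 n) ⟩
    1# * (1# - 0# * p ^ n)          ≈⟨ solve 1 (λ X → :1 :* (:1 :- :0 :* X) := :1) ≈-refl (p ^ n) ⟩
    1#                              ∎

  poch-1 : ∀ n → poch 1# (suc n) ≈ 0#
  poch-1 zero    = solve 0 (:1 :* (:1 :- :1 :* :1) := :0) ≈-refl
  poch-1 (suc n) = ≈-trans (*-congʳ (poch-1 n)) (zeroˡ _)

  -- (x; p)_∞: the factors 1 - x p^j with j > N are 1 modulo q^(N+1).
  poch∞ : Series → Series
  poch∞ x = poch x (suc N)

  poch∞-shift : ∀ x → poch∞ x ≈ (1# - x) * poch∞ (x * p)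
  poch∞-shift x = begin
    poch x (suc N)                              ≈⟨ *-identityʳ _ ⟨
    poch x (suc N) * 1#                         ≈⟨ *-congˡ (solve 1 (λ x → :1 := :1 :- x :* :0) ≈-refl x) ⟩
    poch x (suc N) * (1# - x * 0#)              ≈⟨ *-congˡ (+-congˡ (-‿cong (*-congˡ p^N+1-vanish))) ⟨
    poch x (suc N) * (1# - x * p ^ suc N)       ≈⟨ poch-shift x (suc N) ⟩
    (1# - x) * poch (x * p) (suc N)             ∎

  poch∞-vanish : ∀ {x} → x ≈ 0# → poch∞ x ≈ 1#
  poch∞-vanish x≈0 = ≈-trans (poch-cong (suc N) x≈0) (poch-0 (suc N))

  poch∞-p^ : ∀ m → poch∞ (p ^ m) ≈ (1# - p ^ m) * poch∞ (p ^ suc m)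
  poch∞-p^ m = ≈-trans (poch∞-shift (p ^ m)) (*-congˡ (poch-cong (suc N) (*-comm (p ^ m) p)))

  inv∞ : Series → Series
  inv∞ x = invˢ (poch∞ x)

  Unit-poch∞ : ∀ {x} → NoConstant x → Unit (poch∞ x)
  Unit-poch∞ = Unit-poch (suc N)

  inv∞-cong : ∀ {x y} → NoConstant x → x ≈ y → inv∞ x ≈ inv∞ y
  inv∞-cong x₀≡0 x≈y = invˢ-cong (Unit-poch∞ x₀≡0) (poch-cong (suc N) x≈y)

  inv∞-shift : ∀ {x} → NoConstant x → inv∞ (x * p) ≈ (1# - x) * inv∞ x
  inv∞-shift {x} x₀≡0 = invˢ-factor (1# - x) (Unit-poch∞ x₀≡0) (Unit-poch∞ (NoConstant-*ˡ p x₀≡0))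
                                   (≈-trans (poch∞-shift x) (*-comm _ _))

  inv∞-unshift : ∀ {x} → NoConstant x → inv∞ x ≈ invˢ (1# - x) * inv∞ (x * p)
  inv∞-unshift {x} x₀≡0 = ≈-trans (invˢ-cong (Unit-poch∞ x₀≡0) (poch∞-shift x))
                                  (invˢ-* (Unit-1- x₀≡0) (Unit-poch∞ (NoConstant-*ˡ p x₀≡0)))

  inv∞-vanish : ∀ {x} → NoConstant x → x ≈ 0# → inv∞ x ≈ 1#
  inv∞-vanish x₀≡0 x≈0 = ≈-trans (invˢ-cong (Unit-poch∞ x₀≡0) (poch∞-vanish x≈0)) invˢ-1

  productTerm : ℕ → Series → Series → Series
  productTerm m a b = p ^ m * poch∞ (p ^ suc m) * inv∞ (a * p ^ m) * inv∞ (b * p ^ m)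

  productSum : Series → Series → Series
  productSum a b = ∑[ m ≤ N ] productTerm m a b

  private
    weightedProductSum : Series → Series → Series
    weightedProductSum a b = ∑[ m ≤ N ] (p ^ m * productTerm m a b)

    inv∞-shift-inner : ∀ {a} m → NoConstant a → inv∞ (a * p * p ^ m) ≈ (1# - a * p ^ m) * inv∞ (a * p ^ m)
    inv∞-shift-inner {a} m a₀≡0 = begin
      inv∞ (a * p * p ^ m)         ≈⟨ inv∞-cong (NoConstant-*p^ m (NoConstant-*ˡ p a₀≡0))
                                                (solve 3 (λ a p X → a :* p :* X := a :* X :* p) ≈-refl a p (p ^ m)) ⟩
      inv∞ (a * p ^ m * p)         ≈⟨ inv∞-shift (NoConstant-*p^ m a₀≡0) ⟩
      (1# - a * p ^ m) * inv∞ (a * p ^ m) ∎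

    productTerm-shiftˡ : ∀ m {a} b → NoConstant a → productTerm m (a * p) b ≈ (1# - a * p ^ m) * productTerm m a b
    productTerm-shiftˡ m {a} b a₀≡0 =
      ≈-trans (*-congʳ (*-congˡ (inv∞-shift-inner m a₀≡0)))
              (solve 4 (λ W D A B → W :* (D :* A) :* B := D :* (W :* A :* B)) ≈-refl _ _ _ _)

    productTerm-shiftʳ : ∀ m a {b} → NoConstant b → productTerm m a (b * p) ≈ (1# - b * p ^ m) * productTerm m a b
    productTerm-shiftʳ m a {b} b₀≡0 =
      ≈-trans (*-congˡ (inv∞-shift-inner m b₀≡0))
              (solve 3 (λ W D B → W :* (D :* B) := D :* (W :* B)) ≈-refl _ _ _)

    productTerm-shift : ∀ m {a b} → NoConstant a → NoConstant b →
                        p * productTerm m (a * p) (b * p) ≈ (1# - p ^ suc m) * productTerm (suc m) a b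
    productTerm-shift m {a} {b} a₀≡0 b₀≡0 = begin
      p * (X * poch∞ (p * X) * inv∞ (a * p * X) * inv∞ (b * p * X))
        ≈⟨ *-congˡ (*-cong (*-cong (*-congˡ (poch∞-p^ (suc m))) (inv∞-cong (NoConstant-*p^ m ap₀≡0) (*-assoc a p X)))
                           (inv∞-cong (NoConstant-*p^ m bp₀≡0) (*-assoc b p X))) ⟩
      p * (X * ((1# - p * X) * Q) * A * B)
        ≈⟨ solve 5 (λ p X Q A B → p :* (X :* ((:1 :- p :* X) :* Q) :* A :* B)
                                 := (:1 :- p :* X) :* (p :* X :* Q :* A :* B)) ≈-refl p X Q A B ⟩
      (1# - p * X) * (p * X * Q * A * B)
        ∎
      where
      X = p ^ m
      Q = poch∞ (p * (p * X))
      A = inv∞ (a * (p * X))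
      B = inv∞ (b * (p * X))
      ap₀≡0 = NoConstant-*ˡ p a₀≡0
      bp₀≡0 = NoConstant-*ˡ p b₀≡0

  productSum-cong : ∀ {a a′ b b′} → NoConstant a → NoConstant b →
                    a ≈ a′ → b ≈ b′ → productSum a b ≈ productSum a′ b′
  productSum-cong a₀≡0 b₀≡0 a≈a′ b≈b′ = Σ≤ˢ-cong N (λ m →
    *-cong (*-congˡ (inv∞-cong (NoConstant-*p^ m a₀≡0) (*-congʳ a≈a′)))
           (inv∞-cong (NoConstant-*p^ m b₀≡0) (*-congʳ b≈b′)))

  private
    expand : ∀ a X T → (1# - a * X) * T ≈ T - a * (X * T)
    expand = solve 3 (λ a X T → (:1 :- a :* X) :* T := T :- a :* (X :* T)) ≈-refl

    productSum-shiftˡ : ∀ {a} b → NoConstant a → productSum (a * p) b ≈ productSum a b - a * weightedProductSum a b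
    productSum-shiftˡ {a} b a₀≡0 = begin
      ∑[ m ≤ N ] productTerm m (a * p) b
        ≈⟨ Σ≤ˢ-cong N (λ m → ≈-trans (productTerm-shiftˡ m b a₀≡0) (expand a _ _)) ⟩
      ∑[ m ≤ N ] (productTerm m a b - a * (p ^ m * productTerm m a b)) ≈⟨ Σ≤ˢ-- N _ _ ⟩
      productSum a b - ∑[ m ≤ N ] (a * (p ^ m * productTerm m a b))
        ≈⟨ +-congˡ (-‿cong (Σ≤ˢ-*ˡ N a _)) ⟨
      productSum a b - a * weightedProductSum a b ∎

    productSum-shiftʳ : ∀ a {b} → NoConstant b → productSum a (b * p) ≈ productSum a b - b * weightedProductSum a b
    productSum-shiftʳ a {b} b₀≡0 = begin
      ∑[ m ≤ N ] productTerm m a (b * p)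
        ≈⟨ Σ≤ˢ-cong N (λ m → ≈-trans (productTerm-shiftʳ m a b₀≡0) (expand b _ _)) ⟩
      ∑[ m ≤ N ] (productTerm m a b - b * (p ^ m * productTerm m a b)) ≈⟨ Σ≤ˢ-- N _ _ ⟩
      productSum a b - ∑[ m ≤ N ] (b * (p ^ m * productTerm m a b))
        ≈⟨ +-congˡ (-‿cong (Σ≤ˢ-*ˡ N b _)) ⟨
      productSum a b - b * weightedProductSum a b ∎

    -- The shifted terms telescope: the term m = 0 carries the factor 1 - p⁰ = 0,
    -- and the term m = N + 1 carries p^(N+1) = 0.
    productSum-shift : ∀ {a b} → NoConstant a → NoConstant b →
                       p * productSum (a * p) (b * p) ≈ productSum a b - weightedProductSum a b
    productSum-shift {a} {b} a₀≡0 b₀≡0 = begin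
      p * productSum (a * p) (b * p)
        ≈⟨ Σ≤ˢ-*ˡ N p _ ⟩
      ∑[ m ≤ N ] (p * productTerm m (a * p) (b * p))
        ≈⟨ Σ≤ˢ-cong N (λ m → productTerm-shift m a₀≡0 b₀≡0) ⟩
      Σ≤ˢ N (h ∘ suc)
        ≈⟨ solve 2 (λ x y → y := x :+ y :- x) ≈-refl (h 0) _ ⟩
      h 0 + Σ≤ˢ N (h ∘ suc) - h 0
        ≈⟨ +-congʳ (Σ≤ˢ-front N h) ⟨
      Σ≤ˢ (suc N) h - h 0
        ≈⟨ +-congʳ (Σ≤ˢ-suc N h) ⟩
      Σ≤ˢ N h + h (suc N) - h 0
        ≈⟨ +-cong (+-congˡ h-top) (-‿cong h-bottom) ⟩
      Σ≤ˢ N h + 0# - 0#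
        ≈⟨ solve 1 (λ x → x :+ :0 :- :0 := x) ≈-refl _ ⟩
      Σ≤ˢ N h
        ≈⟨ Σ≤ˢ-cong N (λ m → solve 2 (λ X T → (:1 :- X) :* T := T :- X :* T) ≈-refl _ _) ⟩
      ∑[ m ≤ N ] (productTerm m a b - p ^ m * productTerm m a b) ≈⟨ Σ≤ˢ-- N _ _ ⟩
      productSum a b - weightedProductSum a b         ∎
      where
      h : ℕ → Series
      h m = (1# - p ^ m) * productTerm m a b

      h-bottom : h 0 ≈ 0#
      h-bottom = solve 1 (λ T → (:1 :- :1) :* T := :0) ≈-refl _

      h-top : h (suc N) ≈ 0#
      h-top = begin
        (1# - X) * (X * Q * A * B)
          ≈⟨ *-cong (+-congˡ (-‿cong p^N+1-vanish)) (*-congʳ (*-congʳ (*-congʳ p^N+1-vanish))) ⟩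
        (1# - 0#) * (0# * Q * A * B)
          ≈⟨ solve 3 (λ Q A B → (:1 :- :0) :* (:0 :* Q :* A :* B) := :0) ≈-refl Q A B ⟩
        0# ∎
        where
        X = p ^ suc N
        Q = poch∞ (p ^ suc (suc N))
        A = inv∞ (a * X)
        B = inv∞ (b * X)

    productSum-recˡ : ∀ {a b} → NoConstant a → NoConstant b →
                      (1# - a) * productSum a b ≈ productSum (a * p) b - a * p * productSum (a * p) (b * p)
    productSum-recˡ {a} {b} a₀≡0 b₀≡0 = ≈-sym (begin
      productSum (a * p) b - a * p * productSum (a * p) (b * p)
        ≈⟨ +-cong (productSum-shiftˡ b a₀≡0)
                  (-‿cong (≈-trans (*-assoc a p _) (*-congˡ (productSum-shift a₀≡0 b₀≡0)))) ⟩
      (C - a * S) - a * (C - S)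
        ≈⟨ solve 3 (λ a c s → (c :- a :* s) :- a :* (c :- s) := (:1 :- a) :* c) ≈-refl a C S ⟩
      (1# - a) * C ∎)
      where
      C = productSum a b
      S = weightedProductSum a b

    productSum-recʳ : ∀ {a b} → NoConstant a → NoConstant b →
                      (1# - b) * productSum a b ≈ productSum a (b * p) - b * p * productSum (a * p) (b * p)
    productSum-recʳ {a} {b} a₀≡0 b₀≡0 = ≈-sym (begin
      productSum a (b * p) - b * p * productSum (a * p) (b * p)
        ≈⟨ +-cong (productSum-shiftʳ a b₀≡0)
                  (-‿cong (≈-trans (*-assoc b p _) (*-congˡ (productSum-shift a₀≡0 b₀≡0)))) ⟩
      (C - b * S) - b * (C - S)
        ≈⟨ solve 3 (λ b c s → (c :- b :* s) :- b :* (c :- s) := (:1 :- b) :* c) ≈-refl b C S ⟩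
      (1# - b) * C ∎)
      where
      C = productSum a b
      S = weightedProductSum a b

    -- Invariant under (a,b) ↦ (ap,bp) and zero at a = b = 0, hence zero everywhere.
    functionalDefect : Series → Series → Series
    functionalDefect a b = (1# - a) * productSum a b - b * productSum (a * p) b - 1#

    functionalDefect-shift : ∀ {a b} → NoConstant a → NoConstant b →
                             functionalDefect a b ≈ functionalDefect (a * p) (b * p)
    functionalDefect-shift {a} {b} a₀≡0 b₀≡0 = begin
      (1# - a) * productSum a b - b * C₁ - 1#
        ≈⟨ +-congʳ (+-congʳ (productSum-recˡ a₀≡0 b₀≡0)) ⟩
      (C₁ - a * p * C₂) - b * C₁ - 1#
        ≈⟨ solve 5 (λ a b p y₁ y₂ → (y₁ :- a :* p :* y₂) :- b :* y₁ :- :1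
                                 := (:1 :- b) :* y₁ :- a :* p :* y₂ :- :1) ≈-refl a b p C₁ C₂ ⟩
      (1# - b) * C₁ - a * p * C₂ - 1#
        ≈⟨ +-congʳ (+-congʳ (productSum-recʳ (NoConstant-*ˡ p a₀≡0) b₀≡0)) ⟩
      (C₂ - b * p * C₃) - a * p * C₂ - 1#
        ≈⟨ solve 5 (λ a b p y₂ y₃ → (y₂ :- b :* p :* y₃) :- a :* p :* y₂ :- :1
                                 := (:1 :- a :* p) :* y₂ :- b :* p :* y₃ :- :1) ≈-refl a b p C₂ C₃ ⟩
      (1# - a * p) * C₂ - b * p * C₃ - 1#
        ∎
      where
      C₁ = productSum (a * p) b
      C₂ = productSum (a * p) (b * p)
      C₃ = productSum (a * p * p) (b * p)

    functionalDefect-cong : ∀ {a a′ b b′} → NoConstant a → NoConstant b →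
                            a ≈ a′ → b ≈ b′ → functionalDefect a b ≈ functionalDefect a′ b′
    functionalDefect-cong a₀≡0 b₀≡0 a≈a′ b≈b′ = +-congʳ (+-cong
      (*-cong (+-congˡ (-‿cong a≈a′)) (productSum-cong a₀≡0 b₀≡0 a≈a′ b≈b′))
      (-‿cong (*-cong b≈b′ (productSum-cong (NoConstant-*ˡ p a₀≡0) b₀≡0 (*-congʳ a≈a′) b≈b′))))

    functionalDefect-iterate : ∀ k {a b} → NoConstant a → NoConstant b →
                               functionalDefect a b ≈ functionalDefect (a * p ^ k) (b * p ^ k)
    functionalDefect-iterate zero    {a} {b} a₀≡0 b₀≡0 =
      functionalDefect-cong a₀≡0 b₀≡0 (≈-sym (*-identityʳ a)) (≈-sym (*-identityʳ b))
    functionalDefect-iterate (suc k) {a} {b} a₀≡0 b₀≡0 = begin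
      functionalDefect a b
        ≈⟨ functionalDefect-shift a₀≡0 b₀≡0 ⟩
      functionalDefect (a * p) (b * p)
        ≈⟨ functionalDefect-iterate k ap₀≡0 bp₀≡0 ⟩
      functionalDefect (a * p * p ^ k) (b * p * p ^ k)
        ≈⟨ functionalDefect-cong (NoConstant-*p^ k ap₀≡0) (NoConstant-*p^ k bp₀≡0) (*-assoc a p _) (*-assoc b p _) ⟩
      functionalDefect (a * p ^ suc k) (b * p ^ suc k)
        ∎
      where
      ap₀≡0 = NoConstant-*ˡ p a₀≡0
      bp₀≡0 = NoConstant-*ˡ p b₀≡0

    productSum-0 : productSum 0# 0# ≈ 1#
    productSum-0 = begin
      productSum 0# 0#                                   ≈⟨ Σ≤ˢ-cong N productTerm-0 ⟩
      ∑[ m ≤ N ] (poch∞ (p ^ suc m) - poch∞ (p ^ m))     ≈⟨ Σ≤ˢ-telescope N (λ m → poch∞ (p ^ m)) ⟩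
      poch∞ (p ^ suc N) - poch∞ (p ^ 0)                  ≈⟨ +-cong (poch∞-vanish p^N+1-vanish) (-‿cong (poch-1 N)) ⟩
      1# - 0#                                            ≈⟨ solve 0 (:1 :- :0 := :1) ≈-refl ⟩
      1#                                                 ∎
      where
      productTerm-0 : ∀ m → productTerm m 0# 0# ≈ poch∞ (p ^ suc m) - poch∞ (p ^ m)
      productTerm-0 m = begin
        X * Q * inv∞ (0# * X) * inv∞ (0# * X)
          ≈⟨ *-cong (*-congˡ inv-1) inv-1 ⟩
        X * Q * 1# * 1#
          ≈⟨ solve 2 (λ X Q → X :* Q :* :1 :* :1 := Q :- (:1 :- X) :* Q) ≈-refl X Q ⟩
        Q - (1# - X) * Q
          ≈⟨ +-congˡ (-‿cong (poch∞-p^ m)) ⟨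
        Q - poch∞ X
          ∎
        where
        X = p ^ m
        Q = poch∞ (p ^ suc m)
        inv-1 : inv∞ (0# * X) ≈ 1#
        inv-1 = inv∞-vanish (NoConstant-*ˡ X refl) (zeroˡ X)

    functionalDefect-vanish : ∀ {a b} → NoConstant a → NoConstant b → functionalDefect a b ≈ 0#
    functionalDefect-vanish {a} {b} a₀≡0 b₀≡0 = begin
      functionalDefect a b
        ≈⟨ functionalDefect-iterate (suc N) a₀≡0 b₀≡0 ⟩
      functionalDefect (a * p ^ suc N) (b * p ^ suc N)
        ≈⟨ functionalDefect-cong (NoConstant-*p^ (suc N) a₀≡0) (NoConstant-*p^ (suc N) b₀≡0) (vanish a) (vanish b) ⟩
      functionalDefect 0# 0#
        ≈⟨ +-congʳ (+-congʳ (*-congˡ productSum-0)) ⟩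
      (1# - 0#) * 1# - 0# * productSum (0# * p) 0# - 1#
        ≈⟨ solve 1 (λ c → (:1 :- :0) :* :1 :- :0 :* c :- :1 := :0) ≈-refl _ ⟩
      0#
        ∎
      where
      vanish : ∀ x → x * p ^ suc N ≈ 0#
      vanish x = ≈-trans (*-congˡ p^N+1-vanish) (zeroʳ x)

  productSum-functional : ∀ {a b} → NoConstant a → NoConstant b →
                          (1# - a) * productSum a b ≈ 1# + b * productSum (a * p) b
  productSum-functional {a} {b} a₀≡0 b₀≡0 = begin
    (1# - a) * productSum a b
      ≈⟨ solve 2 (λ x y → x := (x :- y :- :1) :+ (:1 :+ y)) ≈-refl _ _ ⟩
    functionalDefect a b + (1# + b * productSum (a * p) b)
      ≈⟨ +-congʳ (functionalDefect-vanish a₀≡0 b₀≡0) ⟩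
    0# + (1# + b * productSum (a * p) b)
      ≈⟨ +-identityˡ _ ⟩
    1# + b * productSum (a * p) b ∎

  durfeeTerm : ℕ → Series → Series → Series
  durfeeTerm n a b = (a * b) ^ n * p ^ (n ℕ.* n) * invˢ (poch a (suc n)) * invˢ (poch b (suc n))

  durfeeSum : Series → Series → Series
  durfeeSum a b = ∑[ n ≤ N ] durfeeTerm n a b

  private
    invˢ-poch-shift : ∀ {a} n → NoConstant a → (1# - a) * invˢ (poch a (suc n)) ≈ invˢ (poch (a * p) n)
    invˢ-poch-shift {a} n a₀≡0 = ≈-sym (invˢ-factor (1# - a) (Unit-poch (suc n) a₀≡0)
                                                  (Unit-poch n (NoConstant-*ˡ p a₀≡0))
                                                  (≈-trans (poch-shift a n) (*-comm _ _)))

    invˢ-poch-suc : ∀ {x} n → NoConstant x → invˢ (poch x n) ≈ (1# - x * p ^ n) * invˢ (poch x (suc n))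
    invˢ-poch-suc {x} n x₀≡0 = invˢ-factor (1# - x * p ^ n) (Unit-poch (suc n) x₀≡0) (Unit-poch n x₀≡0) ≈-refl

    p^-square : ∀ n → p ^ (suc n ℕ.* suc n) ≈ p ^ (n ℕ.* n) * p ^ n * p ^ n * p
    p^-square n = begin
      p ^ (suc n ℕ.* suc n)
        ≡⟨ cong (λ k → p ^ suc (n ℕ.+ k)) (ℕₚ.*-suc n n) ⟩
      p * p ^ (n ℕ.+ (n ℕ.+ n ℕ.* n))
        ≈⟨ *-congˡ (≈-trans (^-homo-* p n _) (*-congˡ (^-homo-* p n (n ℕ.* n)))) ⟩
      p * (p ^ n * (p ^ n * p ^ (n ℕ.* n)))
        ≈⟨ solve 3 (λ p X Y → p :* (X :* (X :* Y)) := Y :* X :* X :* p) ≈-refl p (p ^ n) _ ⟩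
      p ^ (n ℕ.* n) * p ^ n * p ^ n * p ∎

    durfeeBoundary : ℕ → Series → Series → Series
    durfeeBoundary n a b = (a * b) ^ n * p ^ (n ℕ.* n) * invˢ (poch (a * p) n) * invˢ (poch b n)

    durfeeTerm-telescopes : ∀ n {a b} → NoConstant a → NoConstant b →
      (1# - a) * durfeeTerm n a b - b * durfeeTerm n (a * p) b ≈ durfeeBoundary n a b - durfeeBoundary (suc n) a b
    durfeeTerm-telescopes n {a} {b} a₀≡0 b₀≡0 = begin
      (1# - a) * (Y * Z * V * W₂) - b * ((a * p * b) ^ n * Z * W₁ * W₂)
        ≈⟨ +-cong (≈-trans (reorder _ Y Z V W₂) (*-congʳ (*-congˡ shiftV))) (-‿cong (*-congˡ (*-congʳ (*-congʳ (*-congʳ apb^n))))) ⟩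
      Y * Z * ((1# - a * p * X) * W₁) * W₂ - b * (Y * X * Z * W₁ * W₂)
        ≈⟨ solve 8 (λ a b p X Y Z W₁ W₂ →
             Y :* Z :* ((:1 :- a :* p :* X) :* W₁) :* W₂ :- b :* (Y :* X :* Z :* W₁ :* W₂)
             := Y :* Z :* ((:1 :- a :* p :* X) :* W₁) :* ((:1 :- b :* X) :* W₂)
                :- (a :* b) :* Y :* (Z :* X :* X :* p) :* W₁ :* W₂)
             ≈-refl a b p X Y Z W₁ W₂ ⟩
      Y * Z * ((1# - a * p * X) * W₁) * ((1# - b * X) * W₂) - (a * b) * Y * (Z * X * X * p) * W₁ * W₂
        ≈⟨ +-cong (*-cong (*-congˡ (invˢ-poch-suc n ap₀≡0)) (invˢ-poch-suc n b₀≡0))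
                  (-‿cong (*-congʳ (*-congʳ (*-congˡ (p^-square n))))) ⟨
      durfeeBoundary n a b - durfeeBoundary (suc n) a b
        ∎
      where
      ap₀≡0 = NoConstant-*ˡ p a₀≡0
      reorder = solve 5 (λ d y z v w → d :* (y :* z :* v :* w) := y :* z :* (d :* v) :* w) ≈-refl
      Y = (a * b) ^ n
      Z = p ^ (n ℕ.* n)
      X = p ^ n
      V = invˢ (poch a (suc n))
      W₁ = invˢ (poch (a * p) (suc n))
      W₂ = invˢ (poch b (suc n))

      shiftV : (1# - a) * V ≈ (1# - a * p * X) * W₁
      shiftV = ≈-trans (invˢ-poch-shift n a₀≡0) (invˢ-poch-suc n ap₀≡0)

      apb^n : (a * p * b) ^ n ≈ Y * X
      apb^n = ≈-trans (^-congˡ n (solve 3 (λ a p b → a :* p :* b := a :* b :* p) ≈-refl a p b)) (^-distrib-* (a * b) p n)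

    durfeeBoundary-0 : ∀ a b → durfeeBoundary 0 a b ≈ 1#
    durfeeBoundary-0 a b = begin
      1# * 1# * invˢ 1# * invˢ 1#    ≈⟨ *-cong (*-congˡ invˢ-1) invˢ-1 ⟩
      1# * 1# * 1# * 1#              ≈⟨ solve 0 (:1 :* :1 :* :1 :* :1 := :1) ≈-refl ⟩
      1#                             ∎

    durfeeBoundary-vanish : ∀ a b → durfeeBoundary (suc N) a b ≈ 0#
    durfeeBoundary-vanish a b = begin
      A * p ^ (suc N ℕ.* suc N) * B * D    ≈⟨ *-congʳ (*-congʳ (*-congˡ (p^-vanish (ℕₚ.m≤m*n (suc N) (suc N))))) ⟩
      A * 0# * B * D                       ≈⟨ solve 3 (λ A B D → A :* :0 :* B :* D := :0) ≈-refl A B D ⟩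
      0#                                   ∎
      where
      A = (a * b) ^ suc N
      B = invˢ (poch (a * p) (suc N))
      D = invˢ (poch b (suc N))

  durfeeSum-functional : ∀ {a b} → NoConstant a → NoConstant b →
                         (1# - a) * durfeeSum a b ≈ 1# + b * durfeeSum (a * p) b
  durfeeSum-functional {a} {b} a₀≡0 b₀≡0 = begin
    (1# - a) * durfeeSum a b
      ≈⟨ solve 2 (λ x y → x := (x :- y) :+ y) ≈-refl _ (b * durfeeSum (a * p) b) ⟩
    ((1# - a) * durfeeSum a b - b * durfeeSum (a * p) b) + b * durfeeSum (a * p) b
      ≈⟨ +-congʳ (+-cong (Σ≤ˢ-*ˡ N (1# - a) _) (-‿cong (Σ≤ˢ-*ˡ N b _))) ⟩
    (∑[ n ≤ N ] ((1# - a) * durfeeTerm n a b) - ∑[ n ≤ N ] (b * durfeeTerm n (a * p) b)) + b * durfeeSum (a * p) b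
      ≈⟨ +-congʳ (Σ≤ˢ-- N _ _) ⟨
    ∑[ n ≤ N ] ((1# - a) * durfeeTerm n a b - b * durfeeTerm n (a * p) b) + b * durfeeSum (a * p) b
      ≈⟨ +-congʳ (Σ≤ˢ-cong N (λ n → durfeeTerm-telescopes n a₀≡0 b₀≡0)) ⟩
    ∑[ n ≤ N ] (durfeeBoundary n a b - durfeeBoundary (suc n) a b) + b * durfeeSum (a * p) b
      ≈⟨ +-congʳ (Σ≤ˢ-cong N (λ n → solve 2 (λ x y → x :- y := :0 :- (y :- x)) ≈-refl _ _)) ⟩
    ∑[ n ≤ N ] (0# - (durfeeBoundary (suc n) a b - durfeeBoundary n a b)) + b * durfeeSum (a * p) b
      ≈⟨ +-congʳ (≈-trans (Σ≤ˢ-- N _ _) (+-cong (Σ≤ˢ-zero N (λ _ → ≈-refl))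
                                                (-‿cong (Σ≤ˢ-telescope N (λ n → durfeeBoundary n a b))))) ⟩
    (0# - (durfeeBoundary (suc N) a b - durfeeBoundary 0 a b)) + b * durfeeSum (a * p) b
      ≈⟨ +-congʳ (+-congˡ (-‿cong (+-cong (durfeeBoundary-vanish a b) (-‿cong (durfeeBoundary-0 a b))))) ⟩
    (0# - (0# - 1#)) + b * durfeeSum (a * p) b
      ≈⟨ +-congʳ (solve 0 (:0 :- (:0 :- :1) := :1) ≈-refl) ⟩
    1# + b * durfeeSum (a * p) b
      ∎

  functional-solutions-unique : ∀ {b} (F G : Series → Series) → b ^ suc N ≈ 0# →
    (∀ {a} → NoConstant a → (1# - a) * F a ≈ 1# + b * F (a * p)) →
    (∀ {a} → NoConstant a → (1# - a) * G a ≈ 1# + b * G (a * p)) →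
    ∀ {a} → NoConstant a → F a ≈ G a
  functional-solutions-unique {b} F G b^N+1≈0 F-eq G-eq {a} a₀≡0 = begin
    F a                    ≈⟨ solve 2 (λ x y → x := (x :- y) :+ y) ≈-refl (F a) (G a) ⟩
    Δ a + G a              ≈⟨ +-congʳ (proj₂ (b^k∣Δ (suc N) a₀≡0)) ⟩
    b ^ suc N * V + G a    ≈⟨ +-congʳ (≈-trans (*-congʳ b^N+1≈0) (zeroˡ V)) ⟩
    0# + G a               ≈⟨ +-identityˡ (G a) ⟩
    G a                    ∎
    where
    open import Data.Product using (∃; _,_; proj₁; proj₂)

    Δ : Series → Series
    Δ a = F a - G a

    Δ-eq : ∀ {a} → NoConstant a → (1# - a) * Δ a ≈ b * Δ (a * p)
    Δ-eq {a} a₀≡0 = begin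
      (1# - a) * (F a - G a)
        ≈⟨ solve 3 (λ x y z → x :* (y :- z) := x :* y :- x :* z) ≈-refl _ _ _ ⟩
      (1# - a) * F a - (1# - a) * G a
        ≈⟨ +-cong (F-eq a₀≡0) (-‿cong (G-eq a₀≡0)) ⟩
      (1# + b * F (a * p)) - (1# + b * G (a * p))
        ≈⟨ solve 3 (λ b c d → (:1 :+ b :* c) :- (:1 :+ b :* d) := b :* (c :- d)) ≈-refl _ _ _ ⟩
      b * Δ (a * p) ∎

    b^k∣Δ : ∀ k {a} → NoConstant a → ∃ λ V → Δ a ≈ b ^ k * V
    b^k∣Δ zero    {a} _    = Δ a , ≈-sym (*-identityˡ (Δ a))
    b^k∣Δ (suc k) {a} a₀≡0 with b^k∣Δ k (NoConstant-*ˡ p a₀≡0)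
    ... | V , Δap≈b^kV = invˢ (1# - a) * V , (begin
      Δ a
        ≈⟨ *-identityˡ _ ⟨
      1# * Δ a
        ≈⟨ *-congʳ (invˢ-inverseˡ (Unit-1- a₀≡0)) ⟨
      invˢ (1# - a) * (1# - a) * Δ a
        ≈⟨ *-assoc _ _ _ ⟩
      invˢ (1# - a) * ((1# - a) * Δ a)
        ≈⟨ *-congˡ (Δ-eq a₀≡0) ⟩
      invˢ (1# - a) * (b * Δ (a * p))
        ≈⟨ *-congˡ (*-congˡ Δap≈b^kV) ⟩
      invˢ (1# - a) * (b * (b ^ k * V))
        ≈⟨ solve 4 (λ i b w v → i :* (b :* (w :* v)) := b :* w :* (i :* v)) ≈-refl _ b _ V ⟩
      b * b ^ k * (invˢ (1# - a) * V)       ∎)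

    V : Series
    V = proj₁ (b^k∣Δ (suc N) a₀≡0)

  productSum≈durfeeSum : productSum q q ≈ durfeeSum q q
  productSum≈durfeeSum = functional-solutions-unique (λ a → productSum a q) (λ a → durfeeSum a q) q^N+1-vanish
    (λ a₀≡0 → productSum-functional a₀≡0 refl) (λ a₀≡0 → durfeeSum-functional a₀≡0 refl) refl
    where
    q^N+1-vanish : q ^ suc N ≈ 0#
    q^N+1-vanish = ≈-trans (qpow-^ 1 (suc N)) (qpow-vanish (ℕₚ.≤-reflexive (sym (ℕₚ.*-identityʳ (suc N)))))

  private
    q*p^ : ∀ m → q * p ^ m ≈ qpow (suc (m ℕ.+ m))
    q*p^ m = begin
      q * p ^ m               ≈⟨ *-congˡ (qpow-^ 2 m) ⟩
      q * qpow (m ℕ.* 2)      ≈⟨ qpow-+ 1 (m ℕ.* 2) ⟩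
      qpow (suc (m ℕ.* 2))    ≡⟨ cong (qpow ∘ suc) (m*2≡m+m m) ⟩
      qpow (suc (m ℕ.+ m))    ∎
      where
      m*2≡m+m : ∀ m → m ℕ.* 2 ≡ m ℕ.+ m
      m*2≡m+m m = trans (ℕₚ.*-comm m 2) (cong (m ℕ.+_) (ℕₚ.+-identityʳ m))

    p^suc : ∀ m → p ^ suc m ≈ qpow (suc (suc (m ℕ.+ m)))
    p^suc m = begin
      p * p ^ m                        ≈⟨ *-congʳ (qpow-+ 1 1) ⟨
      q * q * p ^ m                    ≈⟨ *-assoc q q _ ⟩
      q * (q * p ^ m)                  ≈⟨ *-congˡ (q*p^ m) ⟩
      q * qpow (suc (m ℕ.+ m))         ≈⟨ qpow-+ 1 _ ⟩
      qpow (suc (suc (m ℕ.+ m)))       ∎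

    qPoch≈poch : ∀ k → qPoch 1 2 k ≈ poch q k
    qPoch≈poch zero    = oneˢ≈1#
    qPoch≈poch (suc k) = begin
      qPoch 1 2 k *ˢ (oneˢ -ˢ qpow (suc (2 ℕ.* k)))
        ≈⟨ *ˢ≈* _ _ ⟩
      qPoch 1 2 k * (oneˢ -ˢ qpow (suc (2 ℕ.* k)))
        ≈⟨ *-cong (qPoch≈poch k) (≈-trans (-ˢ≈- _ _) (+-cong oneˢ≈1# (-‿cong odd-power))) ⟩
      poch q k * (1# - q * p ^ k) ∎
      where
      odd-power : qpow (suc (2 ℕ.* k)) ≈ q * p ^ k
      odd-power = ≈-sym (≈-trans (q*p^ k) (≈-reflexive (cong (qpow ∘ suc ∘ (k ℕ.+_)) (sym (ℕₚ.+-identityʳ k)))))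

  durfeeSum≈ω : durfeeSum q q ≈ ω
  durfeeSum≈ω = ≈-trans (Σ≤ˢ-cong N durfeeTerm≈ωterm) ω≈Σ≤ˢ
    where
    durfeeTerm≈ωterm : ∀ n → durfeeTerm n q q ≈ ωterm n
    durfeeTerm≈ωterm n = begin
      (q * q) ^ n * p ^ (n ℕ.* n) * J * J      ≈⟨ *-congʳ (*-congʳ (*-congʳ (^-congˡ n (qpow-+ 1 1)))) ⟩
      p ^ n * p ^ (n ℕ.* n) * J * J            ≈⟨ *-congʳ (*-congʳ (^-homo-* p n (n ℕ.* n))) ⟨
      p ^ (n ℕ.+ n ℕ.* n) * J * J              ≈⟨ *-congʳ (*-congʳ (qpow-^ 2 (n ℕ.+ n ℕ.* n))) ⟩
      qpow ((n ℕ.+ n ℕ.* n) ℕ.* 2) * J * J     ≡⟨ cong (λ k → qpow k * J * J) exponent ⟩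
      qpow (2 ℕ.* n ℕ.* n ℕ.+ 2 ℕ.* n) * J * J ≈⟨ *-assoc _ J J ⟩
      qpow (2 ℕ.* n ℕ.* n ℕ.+ 2 ℕ.* n) * (J * J)
        ≈⟨ *-congˡ (*-cong J≈ J≈) ⟩
      qpow (2 ℕ.* n ℕ.* n ℕ.+ 2 ℕ.* n) * (invˢ Q * invˢ Q)
        ≈⟨ ≈-trans (*ˢ≈* _ _) (*-congˡ (*ˢ≈* _ _)) ⟨
      ωterm n ∎
      where
      J = invˢ (poch q (suc n))
      Q = qPoch 1 2 (suc n)
      J≈ : J ≈ invˢ Q
      J≈ = invˢ-cong (Unit-poch (suc n) refl) (≈-sym (qPoch≈poch (suc n)))
      exponent : (n ℕ.+ n ℕ.* n) ℕ.* 2 ≡ 2 ℕ.* n ℕ.* n ℕ.+ 2 ℕ.* n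
      exponent = trans (ℕₚ.*-comm (n ℕ.+ n ℕ.* n) 2) (trans (ℕₚ.*-distribˡ-+ 2 n (n ℕ.* n))
                 (trans (cong (2 ℕ.* n ℕ.+_) (sym (ℕₚ.*-assoc 2 n n))) (ℕₚ.+-comm (2 ℕ.* n) _)))

    ωterm-vanish : ∀ {m n} → m < n → ωterm n m ≡ + 0
    ωterm-vanish {m} {n} m<n = qpow-*ˢ-< (2 ℕ.* n ℕ.* n ℕ.+ 2 ℕ.* n) (invˢ Q *ˢ invˢ Q)
      (ℕₚ.<-≤-trans m<n (ℕₚ.≤-trans (ℕₚ.m≤m+n n (n ℕ.+ 0)) (ℕₚ.m≤n+m (2 ℕ.* n) (2 ℕ.* n ℕ.* n))))
      where Q = qPoch 1 2 (suc n)

    ω≈Σ≤ˢ : Σ≤ˢ N ωterm ≈ ω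
    ω≈Σ≤ˢ m m≤N = Σ≤-extend N (λ n → ωterm n m) m≤N (λ _ → ωterm-vanish)

  tailProduct : ℕ → Series
  tailProduct m = poch∞ (p ^ suc m) * inv∞ (q * p ^ m) * inv∞ (q * p ^ m)

  q*productSum : q * productSum q q ≈ ∑[ m ≤ N ] (qpow (suc (m ℕ.+ m)) * tailProduct m)
  q*productSum = ≈-trans (Σ≤ˢ-*ˡ N q _) (Σ≤ˢ-cong N (λ m →
    ≈-trans (solve 5 (λ q X Q A B → q :* (X :* Q :* A :* B) := q :* X :* (Q :* A :* B)) ≈-refl q (p ^ m) _ _ _)
            (*-congʳ (q*p^ m))))

  pairFactor : ℕ → Series
  pairFactor m = I * (I * (1# - qpow (suc (suc (m ℕ.+ m)))))
    where I = invˢ (1# - qpow (suc (m ℕ.+ m)))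

  tailProduct-rec : ∀ m → tailProduct m ≈ pairFactor m * tailProduct (suc m)
  tailProduct-rec m = begin
    poch∞ (p * X) * inv∞ (q * X) * inv∞ (q * X)
      ≈⟨ *-cong (*-cong (poch∞-p^ (suc m)) inv∞-q*X) inv∞-q*X ⟩
    ((1# - p * X) * Q) * (I * J) * (I * J)
      ≈⟨ solve 4 (λ D Q I J → (D :* Q) :* (I :* J) :* (I :* J) := I :* (I :* D) :* (Q :* J :* J)) ≈-refl _ Q I J ⟩
    I * (I * (1# - p * X)) * tailProduct (suc m)
      ≈⟨ *-congʳ (*-cong I≈ (*-cong I≈ (+-congˡ (-‿cong (p^suc m))))) ⟩
    pairFactor m * tailProduct (suc m)
      ∎
    where
    X = p ^ m
    Q = poch∞ (p * (p * X))
    I = invˢ (1# - q * X)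
    J = inv∞ (q * (p * X))
    q*X₀≡0 : NoConstant (q * X)
    q*X₀≡0 = NoConstant-*ˡ X refl
    inv∞-q*X : inv∞ (q * X) ≈ I * J
    inv∞-q*X = ≈-trans (inv∞-unshift q*X₀≡0)
      (*-congˡ (inv∞-cong (NoConstant-*ˡ p q*X₀≡0) (solve 3 (λ q X p → q :* X :* p := q :* (p :* X)) ≈-refl q X p)))
    I≈ : I ≈ invˢ (1# - qpow (suc (m ℕ.+ m)))
    I≈ = invˢ-cong (Unit-1- q*X₀≡0) (+-congˡ (-‿cong (q*p^ m)))

  tailProduct-beyond : ∀ m → N ≤ m → tailProduct m ≈ 1#
  tailProduct-beyond m N≤m = begin
    poch∞ (p ^ suc m) * inv∞ (q * p ^ m) * inv∞ (q * p ^ m)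
      ≈⟨ *-cong (*-cong (poch∞-vanish (p^-vanish (s≤s N≤m))) inv-1) inv-1 ⟩
    1# * 1# * 1#
      ≈⟨ solve 0 (:1 :* :1 :* :1 := :1) ≈-refl ⟩
    1# ∎
    where
    inv-1 : inv∞ (q * p ^ m) ≈ 1#
    inv-1 = inv∞-vanish (NoConstant-*ˡ (p ^ m) refl)
                        (≈-trans (q*p^ m) (qpow-vanish (s≤s (ℕₚ.≤-trans N≤m (ℕₚ.m≤m+n m m)))))

module ColouredPartitions where

  open Coefficients using (Σ≤-front; Σ≤-cong′; ≡ᵇ-refl; ≢⇒≡ᵇ-false; qpow-*ˢ-≤ᵇ)
  open import Function using (id)
  open import Data.Integer using (_+_; _*_; -1ℤ)
  open import Data.Bool using (_∧_; _∨_; not)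
  import Data.Bool.Properties as Boolₚ
  open import Data.Bool.ListAction using (all; any)
  open import Data.List using (_++_; map; concatMap; replicate; applyUpTo; foldr)
  import Data.List.Properties as Listₚ
  open import Data.List.Relation.Unary.All as All using (All; []; _∷_)
  import Data.List.Relation.Unary.All.Properties as Allₚ
  open import Data.Product using (_×_; _,_; proj₁; proj₂)

  sumOver : {A : Set} → (A → ℤ) → List A → ℤ
  sumOver w = foldr (λ x s → w x + s) (+ 0)

  sumOver-++ : ∀ {A : Set} (w : A → ℤ) xs ys → sumOver w (xs ++ ys) ≡ sumOver w xs + sumOver w ys
  sumOver-++ w []       ys = sym (ℤₚ.+-identityˡ _)
  sumOver-++ w (x ∷ xs) ys = trans (cong (λ s → w x + s) (sumOver-++ w xs ys)) (sym (ℤₚ.+-assoc (w x) _ _))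

  sumOver-map : ∀ {A B : Set} (w : B → ℤ) (g : A → B) xs → sumOver w (map g xs) ≡ sumOver (w ∘ g) xs
  sumOver-map w g []       = refl
  sumOver-map w g (x ∷ xs) = cong (λ s → w (g x) + s) (sumOver-map w g xs)

  sumOver-concatMap : ∀ {A B : Set} (w : B → ℤ) (F : A → List B) xs →
                      sumOver w (concatMap F xs) ≡ sumOver (sumOver w ∘ F) xs
  sumOver-concatMap w F []       = refl
  sumOver-concatMap w F (x ∷ xs) =
    trans (sumOver-++ w (F x) (concatMap F xs)) (cong (λ s → sumOver w (F x) + s) (sumOver-concatMap w F xs))

  sumOver-applyUpTo : ∀ (h : ℕ → ℤ) f m → sumOver h (applyUpTo f (suc m)) ≡ Σ≤ m (h ∘ f)
  sumOver-applyUpTo h f zero    = ℤₚ.+-identityʳ (h (f 0))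
  sumOver-applyUpTo h f (suc m) =
    trans (cong (λ s → h (f 0) + s) (sumOver-applyUpTo h (f ∘ suc) m)) (sym (Σ≤-front m (h ∘ f)))

  sumOver-cong : ∀ {A : Set} {P : A → Set} {w v : A → ℤ} {xs} →
                 All P xs → (∀ x → P x → w x ≡ v x) → sumOver w xs ≡ sumOver v xs
  sumOver-cong []         w≡v = refl
  sumOver-cong (px ∷ pxs) w≡v = cong₂ _+_ (w≡v _ px) (sumOver-cong pxs w≡v)

  sumOver-*ˡ : ∀ {A : Set} c (w : A → ℤ) xs → sumOver (λ x → c * w x) xs ≡ c * sumOver w xs
  sumOver-*ˡ c w []       = sym (ℤₚ.*-zeroʳ c)
  sumOver-*ˡ c w (x ∷ xs) =
    trans (cong (λ s → c * w x + s) (sumOver-*ˡ c w xs)) (sym (ℤₚ.*-distribˡ-+ c (w x) _))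

  All-ptn : ∀ {P : CPart → Set} ps m → All P ps → All (All P) (ptn ps m)
  All-ptn []       zero    _          = [] ∷ []
  All-ptn []       (suc m) _          = []
  All-ptn (p ∷ ps) m       (pp ∷ pps) = Allₚ.concat⁺ (Allₚ.map⁺ (Allₚ.applyUpTo⁺₂ _ (suc m) multiplicity))
    where
    multiplicity : ∀ j → All (All _)
      (if j ℕ.* proj₁ p ≤ᵇ m then map (replicate j p ++_) (ptn ps (m ∸ j ℕ.* proj₁ p)) else [])
    multiplicity j with j ℕ.* proj₁ p ≤ᵇ m
    ... | true  = Allₚ.map⁺ (All.map (Allₚ.++⁺ (Allₚ.replicate⁺ j pp)) (All-ptn ps _ pps))
    ... | false = []

  sumOver-ptn-∷ : ∀ {k} c w ps m → sumOver w (ptn ((k , c) ∷ ps) m)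
                  ≡ Σ≤ m (λ j → (qpow (j ℕ.* k) *ˢ (λ n → sumOver (λ π → w (replicate j (k , c) ++ π)) (ptn ps n))) m)
  sumOver-ptn-∷ {k} c w ps m = begin
    sumOver w (concatMap F (applyUpTo id (suc m)))     ≡⟨ sumOver-concatMap w F (applyUpTo id (suc m)) ⟩
    sumOver (sumOver w ∘ F) (applyUpTo id (suc m))     ≡⟨ sumOver-applyUpTo (sumOver w ∘ F) id m ⟩
    Σ≤ m (sumOver w ∘ F)                               ≡⟨ Σ≤-cong′ m term ⟩
    Σ≤ m (λ j → (qpow (j ℕ.* k) *ˢ W j) m)             ∎
    where
    open ≡-Reasoning

    W : ℕ → Series
    W j n = sumOver (λ π → w (replicate j (k , c) ++ π)) (ptn ps n)

    F : ℕ → List (List CPart)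
    F j = if j ℕ.* k ≤ᵇ m then map (replicate j (k , c) ++_) (ptn ps (m ∸ j ℕ.* k)) else []

    sumOver-F : ∀ j b → sumOver w (if b then map (replicate j (k , c) ++_) (ptn ps (m ∸ j ℕ.* k)) else [])
                      ≡ (if b then W j (m ∸ j ℕ.* k) else + 0)
    sumOver-F j true  = sumOver-map w (replicate j (k , c) ++_) (ptn ps (m ∸ j ℕ.* k))
    sumOver-F j false = refl

    term : ∀ j → sumOver w (F j) ≡ (qpow (j ℕ.* k) *ˢ W j) m
    term j = trans (sumOver-F j (j ℕ.* k ≤ᵇ m)) (sym (qpow-*ˢ-≤ᵇ (j ℕ.* k) (W j) m))

  all-++ : ∀ {A : Set} (f : A → Bool) xs ys → all f (xs ++ ys) ≡ all f xs ∧ all f ys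
  all-++ f []       ys = refl
  all-++ f (x ∷ xs) ys = trans (cong (f x ∧_) (all-++ f xs ys)) (sym (Boolₚ.∧-assoc (f x) _ _))

  all-cong : ∀ {A : Set} {P : A → Set} {f g : A → Bool} {xs} →
             All P xs → (∀ x → P x → f x ≡ g x) → all f xs ≡ all g xs
  all-cong []         f≡g = refl
  all-cong (px ∷ pxs) f≡g = cong₂ _∧_ (f≡g _ px) (all-cong pxs f≡g)

  all-true : ∀ {A : Set} {f : A → Bool} {xs} → All (λ x → f x ≡ true) xs → all f xs ≡ true
  all-true []           = refl
  all-true (fx≡t ∷ all) = cong₂ _∧_ fx≡t (all-true all)

  ∧-interchange₃ : ∀ a b c d e f → (a ∧ b) ∧ (c ∧ d) ∧ (e ∧ f) ≡ (a ∧ c ∧ e) ∧ (b ∧ d ∧ f)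
  ∧-interchange₃ false b c     d e     f = refl
  ∧-interchange₃ true  b false d e     f = Boolₚ.∧-zeroʳ b
  ∧-interchange₃ true  b true  d false f rewrite Boolₚ.∧-zeroʳ d = Boolₚ.∧-zeroʳ b
  ∧-interchange₃ true  b true  d true  f = refl

  countSize-++ : ∀ s xs ys → countSize s (xs ++ ys) ≡ countSize s xs ℕ.+ countSize s ys
  countSize-++ s []            ys = refl
  countSize-++ s ((a , _) ∷ xs) ys =
    trans (cong (δ ℕ.+_) (countSize-++ s xs ys)) (sym (ℕₚ.+-assoc δ _ _))
    where δ = if a ≡ᵇ s then 1 else 0

  numEven-++ : ∀ xs ys → numEven (xs ++ ys) ≡ numEven xs ℕ.+ numEven ys
  numEven-++ []            ys = refl
  numEven-++ ((a , _) ∷ xs) ys =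
    trans (cong (δ ℕ.+_) (numEven-++ xs ys)) (sym (ℕₚ.+-assoc δ _ _))
    where δ = if evenᵇ a then 1 else 0

  sign-+ : ∀ a b → sign (a ℕ.+ b) ≡ sign a * sign b
  sign-+ zero    b = sym (ℤₚ.*-identityˡ _)
  sign-+ (suc a) b = trans (cong ℤ.-_ (sign-+ a b)) (ℤₚ.neg-distribˡ-* (sign a) (sign b))

  signIf : Bool → ℕ → ℤ
  signIf b j = if b then sign j else + 0

  signIf-∧-+ : ∀ a b m n → signIf (a ∧ b) (m ℕ.+ n) ≡ signIf a m * signIf b n
  signIf-∧-+ true  true  m n = sign-+ m n
  signIf-∧-+ true  false m n = sym (ℤₚ.*-zeroʳ (sign m))
  signIf-∧-+ false b     m n = refl

  colourConditions : List CPart → Bool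
  colourConditions π = evenPartsBlue π ∧ evenPartsDistinct π ∧ greenPartsOdd π

  colourWeight : List CPart → ℤ
  colourWeight π = signIf (colourConditions π) (numEven π)

  admissibleWeight : List CPart → ℤ
  admissibleWeight π = signIf (admissible π) (numEven π)

  Tω≡sumOver : ∀ n → Tω n ≡ sumOver admissibleWeight (twoColorPartitions n)
  Tω≡sumOver n = refl

  admissibleWeight-colourWeight : ∀ π → admissibleWeight π ≡ (if smallestOddAndBlue π then colourWeight π else + 0)
  admissibleWeight-colourWeight π =
    last-conjunct (evenPartsBlue π) (evenPartsDistinct π) (greenPartsOdd π) (smallestOddAndBlue π)
    where
    last-conjunct : ∀ a b c d →
                    signIf (a ∧ b ∧ c ∧ d) (numEven π) ≡ (if d then signIf (a ∧ b ∧ c) (numEven π) else + 0)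
    last-conjunct a b c true  rewrite Boolₚ.∧-identityʳ c = refl
    last-conjunct a b c false rewrite Boolₚ.∧-zeroʳ c | Boolₚ.∧-zeroʳ b | Boolₚ.∧-zeroʳ a = refl

  SizeDisjoint : List CPart → List CPart → Set
  SizeDisjoint xs ys = All (λ x → countSize (proj₁ x) ys ≡ 0) xs × All (λ y → countSize (proj₁ y) xs ≡ 0) ys

  evenPartsDistinct-++ : ∀ xs ys → SizeDisjoint xs ys →
                         evenPartsDistinct (xs ++ ys) ≡ evenPartsDistinct xs ∧ evenPartsDistinct ys
  evenPartsDistinct-++ xs ys (xs#ys , ys#xs) =
    trans (all-++ (distinctIn (xs ++ ys)) xs ys)
          (cong₂ _∧_ (all-cong xs#ys (λ x e → sameCount {xs} x (countˡ x e)))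
                     (all-cong ys#xs (λ y e → sameCount {ys} y (countʳ y e))))
    where
    distinctIn : List CPart → CPart → Bool
    distinctIn π x = if evenᵇ (proj₁ x) then countSize (proj₁ x) π ≤ᵇ 1 else true

    sameCount : ∀ {π} x → countSize (proj₁ x) (xs ++ ys) ≡ countSize (proj₁ x) π →
                distinctIn (xs ++ ys) x ≡ distinctIn π x
    sameCount x e = cong (λ c → if evenᵇ (proj₁ x) then c ≤ᵇ 1 else true) e

    countˡ : ∀ x → countSize (proj₁ x) ys ≡ 0 → countSize (proj₁ x) (xs ++ ys) ≡ countSize (proj₁ x) xs
    countˡ x e =
      trans (countSize-++ (proj₁ x) xs ys) (trans (cong (countSize (proj₁ x) xs ℕ.+_) e) (ℕₚ.+-identityʳ _))

    countʳ : ∀ y → countSize (proj₁ y) xs ≡ 0 → countSize (proj₁ y) (xs ++ ys) ≡ countSize (proj₁ y) ys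
    countʳ y e = trans (countSize-++ (proj₁ y) xs ys) (cong (ℕ._+ countSize (proj₁ y) ys) e)

  colourWeight-++ : ∀ xs ys → SizeDisjoint xs ys → colourWeight (xs ++ ys) ≡ colourWeight xs * colourWeight ys
  colourWeight-++ xs ys disjoint = begin
    signIf (colourConditions (xs ++ ys)) (numEven (xs ++ ys))
      ≡⟨ cong₂ signIf conditions (numEven-++ xs ys) ⟩
    signIf (colourConditions xs ∧ colourConditions ys) (numEven xs ℕ.+ numEven ys)
      ≡⟨ signIf-∧-+ (colourConditions xs) (colourConditions ys) (numEven xs) (numEven ys) ⟩
    colourWeight xs * colourWeight ys ∎
    where
    open ≡-Reasoning
    conditions : colourConditions (xs ++ ys) ≡ colourConditions xs ∧ colourConditions ys
    conditions = trans (cong₂ _∧_ (all-++ _ xs ys) (cong₂ _∧_ (evenPartsDistinct-++ xs ys disjoint) (all-++ _ xs ys)))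
                       (∧-interchange₃ (evenPartsBlue xs) (evenPartsBlue ys)
                                       (evenPartsDistinct xs) (evenPartsDistinct ys)
                                       (greenPartsOdd xs) (greenPartsOdd ys))

  Above : ℕ → List CPart → Set
  Above k = All (λ x → k < proj₁ x)

  blockOf : ℕ → ℕ → ℕ → List CPart
  blockOf k j₁ j₂ = replicate j₁ (k , blue) ++ replicate j₂ (k , green)

  block : ℕ → ℕ → ℕ → List CPart → List CPart
  block k j₁ j₂ π = replicate j₁ (k , blue) ++ replicate j₂ (k , green) ++ π

  blockOf-disjoint : ∀ {k π} j₁ j₂ → Above k π → SizeDisjoint (blockOf k j₁ j₂) π
  blockOf-disjoint {k} {π} j₁ j₂ above =
    Allₚ.++⁺ (Allₚ.replicate⁺ j₁ (absent π above)) (Allₚ.replicate⁺ j₂ (absent π above)) ,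
    All.map (λ {y} k<y → trans (countSize-++ (proj₁ y) (replicate j₁ (k , blue)) _)
                               (cong₂ ℕ._+_ (not-in-block j₁ (ℕₚ.<⇒≢ k<y)) (not-in-block j₂ (ℕₚ.<⇒≢ k<y)))) above
    where
    absent : ∀ π → Above k π → countSize k π ≡ 0
    absent []            []            = refl
    absent ((s , _) ∷ π) (k<s ∷ above) rewrite ≢⇒≡ᵇ-false (ℕₚ.>⇒≢ k<s) = absent π above

    not-in-block : ∀ {s c} j → k ≢ s → countSize s (replicate j (k , c)) ≡ 0
    not-in-block zero    _   = refl
    not-in-block (suc j) k≢s rewrite ≢⇒≡ᵇ-false k≢s = not-in-block j k≢s

  colourWeight-block : ∀ {k π} j₁ j₂ → Above k π →
                       colourWeight (block k j₁ j₂ π) ≡ colourWeight (blockOf k j₁ j₂) * colourWeight π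
  colourWeight-block {k} {π} j₁ j₂ above =
    trans (cong colourWeight (sym (Listₚ.++-assoc (replicate j₁ (k , blue)) (replicate j₂ (k , green)) π)))
          (colourWeight-++ (blockOf k j₁ j₂) π (blockOf-disjoint j₁ j₂ above))

  colourWeight-odd : ∀ {π} → All (λ x → evenᵇ (proj₁ x) ≡ false) π → colourWeight π ≡ + 1
  colourWeight-odd {π} odd = cong₂ signIf
    (cong₂ _∧_ (all-true (All.map (λ {x} → evenBlue x) odd))
               (cong₂ _∧_ (all-true (All.map (λ {x} → distinct x) odd))
                          (all-true (All.map (λ {x} → greenOdd x) odd))))
    (noEven odd)
    where
    evenBlue : ∀ x → evenᵇ (proj₁ x) ≡ false → (if evenᵇ (proj₁ x) then isBlue (proj₂ x) else true) ≡ true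
    evenBlue x = cong (if_then isBlue (proj₂ x) else true)

    distinct : ∀ x → evenᵇ (proj₁ x) ≡ false → (if evenᵇ (proj₁ x) then countSize (proj₁ x) π ≤ᵇ 1 else true) ≡ true
    distinct x = cong (if_then countSize (proj₁ x) π ≤ᵇ 1 else true)

    greenOdd : ∀ x → evenᵇ (proj₁ x) ≡ false → (if isBlue (proj₂ x) then true else not (evenᵇ (proj₁ x))) ≡ true
    greenOdd (_ , blue)  _ = refl
    greenOdd (_ , green) e = cong not e

    noEven : ∀ {π} → All (λ x → evenᵇ (proj₁ x) ≡ false) π → numEven π ≡ 0
    noEven []        = refl
    noEven (e ∷ odd) rewrite e = noEven odd

  colourWeight-blue-fails : ∀ π → evenPartsBlue π ≡ false → colourWeight π ≡ + 0
  colourWeight-blue-fails π e = cong (λ b → signIf (b ∧ evenPartsDistinct π ∧ greenPartsOdd π) (numEven π)) e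

  colourWeight-distinct-fails : ∀ π → evenPartsDistinct π ≡ false → colourWeight π ≡ + 0
  colourWeight-distinct-fails π e = cong (λ b → signIf b (numEven π))
    (trans (cong (λ b → evenPartsBlue π ∧ b ∧ greenPartsOdd π) e) (Boolₚ.∧-zeroʳ (evenPartsBlue π)))

  colourWeight-blockOf-odd : ∀ {k} j₁ j₂ → evenᵇ k ≡ false → colourWeight (blockOf k j₁ j₂) ≡ + 1
  colourWeight-blockOf-odd j₁ j₂ e = colourWeight-odd (Allₚ.++⁺ (Allₚ.replicate⁺ j₁ e) (Allₚ.replicate⁺ j₂ e))

  colourWeight-blockOf-green : ∀ {k} j₁ j₂ → evenᵇ k ≡ true → colourWeight (blockOf k j₁ (suc j₂)) ≡ + 0
  colourWeight-blockOf-green {k} j₁ j₂ e = colourWeight-blue-fails (blockOf k j₁ (suc j₂))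
    (trans (all-++ evenBlue (replicate j₁ (k , blue)) (replicate (suc j₂) (k , green)))
           (trans (cong (blues ∧_) greenFails) (Boolₚ.∧-zeroʳ blues)))
    where
    evenBlue : CPart → Bool
    evenBlue x = if evenᵇ (proj₁ x) then isBlue (proj₂ x) else true

    blues = all evenBlue (replicate j₁ (k , blue))

    greenFails : all evenBlue (replicate (suc j₂) (k , green)) ≡ false
    greenFails rewrite e = refl

  colourWeight-blockOf-1 : ∀ {k} → evenᵇ k ≡ true → colourWeight (blockOf k 1 0) ≡ -1ℤ
  colourWeight-blockOf-1 {k} e rewrite e | ≡ᵇ-refl k = refl

  colourWeight-blockOf-2+ : ∀ {k} j → evenᵇ k ≡ true → colourWeight (blockOf k (2 ℕ.+ j) 0) ≡ + 0
  colourWeight-blockOf-2+ {k} j e = colourWeight-distinct-fails (blockOf k (2 ℕ.+ j) 0) repeated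
    where
    repeated : evenPartsDistinct (blockOf k (2 ℕ.+ j) 0) ≡ false
    repeated rewrite e | ≡ᵇ-refl k = refl

  all-false : ∀ {A : Set} {f : A → Bool} {xs} → All (λ x → f x ≡ false) xs → any f xs ≡ false
  all-false []           = refl
  all-false (fx≡f ∷ all) = cong₂ _∨_ fx≡f (all-false all)

  private
    minSize-block : ∀ {k} c rest → All (λ y → k ≤ proj₁ y) rest → minSize ((k , c) ∷ rest) ≡ k
    minSize-block c []           []           = refl
    minSize-block c (y ∷ rest) (k≤y ∷ k≤rest) =
      trans (cong (proj₁ y ℕ.⊓_) (minSize-block c rest k≤rest)) (ℕₚ.m≥n⇒m⊓n≡n k≤y)

    Above⇒≤ : ∀ {k π} j₁ j₂ → Above k π → All (λ y → k ≤ proj₁ y) (block k j₁ j₂ π)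
    Above⇒≤ j₁ j₂ above = Allₚ.++⁺ (Allₚ.replicate⁺ j₁ ℕₚ.≤-refl)
                             (Allₚ.++⁺ (Allₚ.replicate⁺ j₂ ℕₚ.≤-refl) (All.map ℕₚ.<⇒≤ above))

  smallestOddAndBlue-blue : ∀ {k π} j j₂ → Above k π → smallestOddAndBlue (block k (suc j) j₂ π) ≡ not (evenᵇ k)
  smallestOddAndBlue-blue {k} {π} j j₂ above
    rewrite minSize-block blue (block k j j₂ π) (Above⇒≤ j j₂ above) | ≡ᵇ-refl k =
    Boolₚ.∧-identityʳ (not (evenᵇ k))

  smallestOddAndBlue-green : ∀ {k π} j → Above k π → smallestOddAndBlue (block k 0 (suc j) π) ≡ false
  smallestOddAndBlue-green {k} {π} j above = begin
    not (evenᵇ (minSize L)) ∧ any (isSmallestBlue (minSize L)) L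
      ≡⟨ cong (λ m → not (evenᵇ m) ∧ any (isSmallestBlue m) L)
              (minSize-block green (block k 0 j π) (Above⇒≤ 0 j above)) ⟩
    not (evenᵇ k) ∧ any (isSmallestBlue k) L
      ≡⟨ cong (not (evenᵇ k) ∧_) (all-false noSmallestBlue) ⟩
    not (evenᵇ k) ∧ false
      ≡⟨ Boolₚ.∧-zeroʳ (not (evenᵇ k)) ⟩
    false ∎
    where
    open ≡-Reasoning
    L = block k 0 (suc j) π

    isSmallestBlue : ℕ → CPart → Bool
    isSmallestBlue m x = (proj₁ x ≡ᵇ m) ∧ isBlue (proj₂ x)

    noSmallestBlue : All (λ x → isSmallestBlue k x ≡ false) L
    noSmallestBlue = Allₚ.++⁺ (Allₚ.replicate⁺ (suc j) (Boolₚ.∧-zeroʳ (k ≡ᵇ k)))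
                              (All.map (λ {x} k<s → cong (_∧ isBlue (proj₂ x)) (≢⇒≡ᵇ-false (ℕₚ.>⇒≢ k<s))) above)

  admissibleWeight-green : ∀ {k π} j → Above k π → admissibleWeight (block k 0 (suc j) π) ≡ + 0
  admissibleWeight-green {k} {π} j above = trans (admissibleWeight-colourWeight (block k 0 (suc j) π))
    (cong (if_then colourWeight (block k 0 (suc j) π) else + 0) (smallestOddAndBlue-green j above))

  admissibleWeight-blue : ∀ {k π} j j₂ → Above k π →
                admissibleWeight (block k (suc j) j₂ π) ≡ (if not (evenᵇ k) then colourWeight (block k (suc j) j₂ π) else + 0)
  admissibleWeight-blue {k} {π} j j₂ above = trans (admissibleWeight-colourWeight (block k (suc j) j₂ π))
    (cong (if_then colourWeight (block k (suc j) j₂ π) else + 0) (smallestOddAndBlue-blue j j₂ above))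

  admissibleWeight-blue-odd : ∀ {k π} j j₂ → evenᵇ k ≡ false → Above k π → admissibleWeight (block k (suc j) j₂ π) ≡ colourWeight π
  admissibleWeight-blue-odd {k} {π} j j₂ odd above = begin
    admissibleWeight (block k (suc j) j₂ π)
      ≡⟨ admissibleWeight-blue j j₂ above ⟩
    (if not (evenᵇ k) then colourWeight (block k (suc j) j₂ π) else + 0)
      ≡⟨ cong (λ b → if not b then colourWeight (block k (suc j) j₂ π) else + 0) odd ⟩
    colourWeight (block k (suc j) j₂ π)
      ≡⟨ colourWeight-block (suc j) j₂ above ⟩
    colourWeight (blockOf k (suc j) j₂) * colourWeight π
      ≡⟨ cong (_* colourWeight π) (colourWeight-blockOf-odd {k} (suc j) j₂ odd) ⟩
    + 1 * colourWeight π
      ≡⟨ ℤₚ.*-identityˡ _ ⟩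
    colourWeight π ∎
    where open ≡-Reasoning

  admissibleWeight-blue-even : ∀ {k π} j j₂ → evenᵇ k ≡ true → Above k π → admissibleWeight (block k (suc j) j₂ π) ≡ + 0
  admissibleWeight-blue-even {k} {π} j j₂ even above =
    trans (admissibleWeight-blue j j₂ above) (cong (λ b → if not b then colourWeight (block k (suc j) j₂ π) else + 0) even)

module PartitionSeries (N : ℕ) where

  open Coefficients
  open Truncated N
  open ColouredPartitions
  open Solver using (solve; _:+_; _:*_; _:-_; _:=_; con)
  open import Data.List using (_++_; concatMap; replicate; applyUpTo)
  open import Data.List.Relation.Unary.All using (All; []; _∷_)
  import Data.List.Relation.Unary.All as All
  open import Data.Product using (_,_)
  open import Function using (id)
  open import Relation.Binary.PropositionalEquality using (subst)

  partitionSeries : (List CPart → ℤ) → List CPart → Series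
  partitionSeries w ps m = sumOver w (ptn ps m)

  colourSeries admissibleSeries : List CPart → Series
  colourSeries = partitionSeries colourWeight
  admissibleSeries = partitionSeries admissibleWeight

  partitionSeries-∷ : ∀ {k} c w ps → 1 ≤ k → partitionSeries w ((k , c) ∷ ps) ≈
    ∑[ j ≤ N ] (qpow (j ℕ.* k) * partitionSeries (λ π → w (replicate j (k , c) ++ π)) ps)
  partitionSeries-∷ {k@(suc _)} c w ps _ m m≤N =
    trans (sumOver-ptn-∷ c w ps m)
          (trans (sym (Σ≤-extend N g m≤N vanish)) (Σ≤-cong′ N (λ j → sym (⊛-def (qpow (j ℕ.* k)) (W j) m))))
    where
    W : ℕ → Series
    W j = partitionSeries (λ π → w (replicate j (k , c) ++ π)) ps

    g : ℕ → ℤ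
    g j = (qpow (j ℕ.* k) *ˢ W j) m

    vanish : ∀ j → m < j → g j ≡ + 0
    vanish j m<j = qpow-*ˢ-< (j ℕ.* k) (W j) (ℕₚ.<-≤-trans m<j (ℕₚ.m≤m*n j k))

  partitionSeries-scale : ∀ {k} c {w v} ps → Above k ps → (∀ π → Above k π → w π ≡ c ℤ.* v π) →
                          partitionSeries w ps ≈ constˢ c * partitionSeries v ps
  partitionSeries-scale c {w} {v} ps above w≡cv n _ =
    trans (sumOver-cong (All-ptn ps n above) w≡cv)
          (trans (sumOver-*ˡ c v (ptn ps n)) (sym (constˢ-*-coefficient c (partitionSeries v ps) n)))

  geometric-head : ∀ {k} → 1 ≤ k → (F : ℕ → Series) →
    ∑[ j ≤ N ] (qpow (j ℕ.* k) * F j) ≈ F 0 + qpow k * ∑[ j ≤ N ] (qpow (j ℕ.* k) * F (suc j))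
  geometric-head {k@(suc _)} _ F = begin
    Σ≤ˢ N g                                                   ≈⟨ +-identityʳ _ ⟨
    Σ≤ˢ N g + 0#                                              ≈⟨ +-congˡ g-beyond ⟨
    Σ≤ˢ N g + g (suc N)                                       ≈⟨ Σ≤ˢ-suc N g ⟨
    Σ≤ˢ (suc N) g                                             ≈⟨ Σ≤ˢ-front N g ⟩
    g 0 + Σ≤ˢ N (g ∘ suc)                                     ≈⟨ +-cong g-0 (Σ≤ˢ-cong N g-suc) ⟩
    F 0 + ∑[ j ≤ N ] (qpow k * (qpow (j ℕ.* k) * F (suc j)))  ≈⟨ +-congˡ (Σ≤ˢ-*ˡ N (qpow k) _) ⟨
    F 0 + qpow k * ∑[ j ≤ N ] (qpow (j ℕ.* k) * F (suc j))    ∎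
    where
    g : ℕ → Series
    g j = qpow (j ℕ.* k) * F j

    g-beyond : g (suc N) ≈ 0#
    g-beyond = ≈-trans (*-congʳ (qpow-vanish (ℕₚ.m≤m*n (suc N) k))) (zeroˡ _)

    g-0 : g 0 ≈ F 0
    g-0 = ≈-trans (*-congʳ qpow-0) (*-identityˡ _)

    g-suc : ∀ j → g (suc j) ≈ qpow k * (qpow (j ℕ.* k) * F (suc j))
    g-suc j = ≈-trans (*-congʳ (≈-sym (qpow-+ k (j ℕ.* k)))) (*-assoc _ _ _)

  geometric-zero : ∀ {k} (F : ℕ → Series) → (∀ j → F j ≈ 0#) → ∑[ j ≤ N ] (qpow (j ℕ.* k) * F j) ≈ 0#
  geometric-zero F F≈0 = Σ≤ˢ-zero N (λ j → ≈-trans (*-congˡ (F≈0 j)) (zeroʳ _))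

  geometric-head-only : ∀ {k} → 1 ≤ k → (F : ℕ → Series) → (∀ j → F (suc j) ≈ 0#) →
                        ∑[ j ≤ N ] (qpow (j ℕ.* k) * F j) ≈ F 0
  geometric-head-only {k} 1≤k F F-tail≈0 = begin
    ∑[ j ≤ N ] (qpow (j ℕ.* k) * F j)
      ≈⟨ geometric-head 1≤k F ⟩
    F 0 + qpow k * ∑[ j ≤ N ] (qpow (j ℕ.* k) * F (suc j))
      ≈⟨ +-congˡ (*-congˡ (geometric-zero (F ∘ suc) F-tail≈0)) ⟩
    F 0 + qpow k * 0#
      ≈⟨ solve 2 (λ x y → x :+ y :* :0 := x) ≈-refl (F 0) (qpow k) ⟩
    F 0 ∎

  geometric : ∀ {k} → 1 ≤ k → (F : Series) → ∑[ j ≤ N ] (qpow (j ℕ.* k) * F) ≈ invˢ (1# - qpow k) * F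
  geometric {k@(suc _)} 1≤k F = begin
    G                                ≈⟨ *-identityˡ G ⟨
    1# * G                           ≈⟨ *-congʳ (invˢ-inverseˡ (Unit-1- refl)) ⟨
    invˢ (1# - qpow k) * (1# - qpow k) * G   ≈⟨ *-assoc _ _ G ⟩
    invˢ (1# - qpow k) * ((1# - qpow k) * G) ≈⟨ *-congˡ (1-qᵏ*G≈F) ⟩
    invˢ (1# - qpow k) * F           ∎
    where
    G = ∑[ j ≤ N ] (qpow (j ℕ.* k) * F)

    1-qᵏ*G≈F : (1# - qpow k) * G ≈ F
    1-qᵏ*G≈F = begin
      (1# - qpow k) * G                  ≈⟨ solve 2 (λ x G → (:1 :- x) :* G := G :- x :* G) ≈-refl (qpow k) G ⟩
      G - qpow k * G                     ≈⟨ +-congʳ (geometric-head 1≤k (λ _ → F)) ⟩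
      (F + qpow k * G) - qpow k * G      ≈⟨ solve 2 (λ a b → (a :+ b) :- b := a) ≈-refl F (qpow k * G) ⟩
      F                                  ∎

  geometric-≈ : ∀ {k} → 1 ≤ k → (F : ℕ → Series) {G : Series} → (∀ j → F j ≈ G) →
                ∑[ j ≤ N ] (qpow (j ℕ.* k) * F j) ≈ invˢ (1# - qpow k) * G
  geometric-≈ 1≤k F F≈G = ≈-trans (Σ≤ˢ-cong N (λ j → *-congˡ (F≈G j))) (geometric 1≤k _)

  pair : ℕ → List CPart → List CPart
  pair k ps = (k , blue) ∷ (k , green) ∷ ps

  partitionSeries-pair : ∀ {k} w ps → 1 ≤ k → partitionSeries w (pair k ps) ≈
    ∑[ j₁ ≤ N ] (qpow (j₁ ℕ.* k) * ∑[ j₂ ≤ N ] (qpow (j₂ ℕ.* k) * partitionSeries (w ∘ block k j₁ j₂) ps))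
  partitionSeries-pair {k} w ps 1≤k = ≈-trans (partitionSeries-∷ blue w ((k , green) ∷ ps) 1≤k)
    (Σ≤ˢ-cong N (λ j₁ → *-congˡ (partitionSeries-∷ green (λ π → w (replicate j₁ (k , blue) ++ π)) ps 1≤k)))

  module _ {k ps} (1≤k : 1 ≤ k) (above : Above k ps) where

    private
      I = invˢ (1# - qpow k)

      scale : ∀ c {w v} → (∀ π → Above k π → w π ≡ c ℤ.* v π) → partitionSeries w ps ≈ constˢ c * partitionSeries v ps
      scale c = partitionSeries-scale c ps above

      vanishes : ∀ {w} → (∀ π → Above k π → w π ≡ + 0) → partitionSeries w ps ≈ 0#
      vanishes {w} w≡0 = ≈-trans (scale (+ 0) {v = w} w≡0) (zeroˡ _)

      unchanged : ∀ {w v} → (∀ π → Above k π → w π ≡ v π) → partitionSeries w ps ≈ partitionSeries v ps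
      unchanged w≡v = ≈-trans (scale (+ 1) (λ π a → trans (w≡v π a) (sym (ℤₚ.*-identityˡ _)))) (*-identityˡ _)

      admissibleBlocks : ℕ → Series
      admissibleBlocks j₁ = ∑[ j₂ ≤ N ] (qpow (j₂ ℕ.* k) * partitionSeries (admissibleWeight ∘ block k j₁ j₂) ps)

      admissibleBlocks-0 : admissibleBlocks 0 ≈ admissibleSeries ps
      admissibleBlocks-0 = geometric-head-only 1≤k (λ j₂ → partitionSeries (admissibleWeight ∘ block k 0 j₂) ps)
                                           (λ j₂ → vanishes (λ π → admissibleWeight-green j₂))

    colourSeries-pair-odd : evenᵇ k ≡ false → colourSeries (pair k ps) ≈ I * (I * colourSeries ps)
    colourSeries-pair-odd odd = begin
      colourSeries (pair k ps)
        ≈⟨ partitionSeries-pair colourWeight ps 1≤k ⟩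
      ∑[ j₁ ≤ N ] (qpow (j₁ ℕ.* k) * ∑[ j₂ ≤ N ] (qpow (j₂ ℕ.* k) * W j₁ j₂))
        ≈⟨ geometric-≈ 1≤k _ (λ j₁ → geometric-≈ 1≤k (W j₁) (λ j₂ → unchanged (oddBlock j₁ j₂))) ⟩
      I * (I * colourSeries ps) ∎
      where
      W : ℕ → ℕ → Series
      W j₁ j₂ = partitionSeries (colourWeight ∘ block k j₁ j₂) ps

      oddBlock : ∀ j₁ j₂ π → Above k π → colourWeight (block k j₁ j₂ π) ≡ colourWeight π
      oddBlock j₁ j₂ π a = trans (colourWeight-block j₁ j₂ a)
        (trans (cong (ℤ._* colourWeight π) (colourWeight-blockOf-odd j₁ j₂ odd)) (ℤₚ.*-identityˡ _))

    colourSeries-pair-even : evenᵇ k ≡ true → colourSeries (pair k ps) ≈ (1# - qpow k) * colourSeries ps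
    colourSeries-pair-even even = begin
      colourSeries (pair k ps)
        ≈⟨ partitionSeries-pair colourWeight ps 1≤k ⟩
      ∑[ j₁ ≤ N ] (qpow (j₁ ℕ.* k) * ∑[ j₂ ≤ N ] (qpow (j₂ ℕ.* k) * W j₁ j₂))
        ≈⟨ Σ≤ˢ-cong N (λ j₁ → *-congˡ (geometric-head-only 1≤k (W j₁) (λ j₂ → vanishes (greenBlock j₁ j₂)))) ⟩
      ∑[ j₁ ≤ N ] (qpow (j₁ ℕ.* k) * W j₁ 0)
        ≈⟨ geometric-head 1≤k (λ j₁ → W j₁ 0) ⟩
      Y + qpow k * ∑[ j ≤ N ] (qpow (j ℕ.* k) * W (suc j) 0)
        ≈⟨ +-congˡ (*-congˡ (geometric-head-only 1≤k (λ j → W (suc j) 0) (λ j → vanishes (repeatedBlock j)))) ⟩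
      Y + qpow k * W 1 0
        ≈⟨ +-congˡ (*-congˡ (scale ℤ.-1ℤ oneBlock)) ⟩
      Y + qpow k * (constˢ ℤ.-1ℤ * Y)
        ≈⟨ solve 2 (λ x Y → Y :+ x :* (con ℤ.-1ℤ :* Y) := (:1 :- x) :* Y) ≈-refl (qpow k) Y ⟩
      (1# - qpow k) * Y ∎
      where
      Y = colourSeries ps

      W : ℕ → ℕ → Series
      W j₁ j₂ = partitionSeries (colourWeight ∘ block k j₁ j₂) ps

      byBlockOf : ∀ {j₁ j₂ c} → colourWeight (blockOf k j₁ j₂) ≡ c →
                  ∀ π → Above k π → colourWeight (block k j₁ j₂ π) ≡ c ℤ.* colourWeight π
      byBlockOf {j₁} {j₂} {c} e π a = trans (colourWeight-block j₁ j₂ a) (cong (ℤ._* colourWeight π) e)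

      greenBlock : ∀ j₁ j₂ π → Above k π → colourWeight (block k j₁ (suc j₂) π) ≡ + 0
      greenBlock j₁ j₂ = byBlockOf {j₁} {suc j₂} (colourWeight-blockOf-green j₁ j₂ even)

      repeatedBlock : ∀ j π → Above k π → colourWeight (block k (2 ℕ.+ j) 0 π) ≡ + 0
      repeatedBlock j = byBlockOf {2 ℕ.+ j} {0} (colourWeight-blockOf-2+ {k} j even)

      oneBlock : ∀ π → Above k π → colourWeight (block k 1 0 π) ≡ ℤ.-1ℤ ℤ.* colourWeight π
      oneBlock = byBlockOf {1} {0} (colourWeight-blockOf-1 {k} even)

    admissibleSeries-pair-odd : evenᵇ k ≡ false →
                            admissibleSeries (pair k ps) ≈ admissibleSeries ps + qpow k * (I * (I * colourSeries ps))
    admissibleSeries-pair-odd odd = begin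
      admissibleSeries (pair k ps)
        ≈⟨ partitionSeries-pair admissibleWeight ps 1≤k ⟩
      ∑[ j₁ ≤ N ] (qpow (j₁ ℕ.* k) * admissibleBlocks j₁)
        ≈⟨ geometric-head 1≤k admissibleBlocks ⟩
      admissibleBlocks 0 + qpow k * ∑[ j ≤ N ] (qpow (j ℕ.* k) * admissibleBlocks (suc j))
        ≈⟨ +-cong admissibleBlocks-0
                  (*-congˡ (geometric-≈ 1≤k _ (λ j → geometric-≈ 1≤k _ (λ j₂ → unchanged (blueOdd j j₂))))) ⟩
      admissibleSeries ps + qpow k * (I * (I * colourSeries ps)) ∎
      where
      blueOdd : ∀ j j₂ π → Above k π → admissibleWeight (block k (suc j) j₂ π) ≡ colourWeight π
      blueOdd j j₂ π = admissibleWeight-blue-odd j j₂ odd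

    admissibleSeries-pair-even : evenᵇ k ≡ true → admissibleSeries (pair k ps) ≈ admissibleSeries ps
    admissibleSeries-pair-even even = begin
      admissibleSeries (pair k ps)
        ≈⟨ partitionSeries-pair admissibleWeight ps 1≤k ⟩
      ∑[ j₁ ≤ N ] (qpow (j₁ ℕ.* k) * admissibleBlocks j₁)
        ≈⟨ geometric-head-only 1≤k admissibleBlocks
             (λ j → geometric-zero _ (λ j₂ → vanishes (λ π → admissibleWeight-blue-even j j₂ even))) ⟩
      admissibleBlocks 0
        ≈⟨ admissibleBlocks-0 ⟩
      admissibleSeries ps ∎

  partsFrom : ℕ → ℕ → List CPart
  partsFrom c zero    = []
  partsFrom c (suc L) = pair (suc c) (partsFrom (suc c) L)

  allParts≡partsFrom : ∀ n → allParts n ≡ partsFrom 0 n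
  allParts≡partsFrom n = pairs n id 0 (λ _ → refl)
    where
    pairs : ∀ L f c → (∀ i → f i ≡ c ℕ.+ i) →
            concatMap (λ k → (suc k , blue) ∷ (suc k , green) ∷ []) (applyUpTo f L) ≡ partsFrom c L
    pairs zero    f c f≗c+ = refl
    pairs (suc L) f c f≗c+ = cong₂ (λ a rest → pair (suc a) rest) (trans (f≗c+ 0) (ℕₚ.+-identityʳ c))
                                   (pairs L (f ∘ suc) (suc c) (λ i → trans (f≗c+ (suc i)) (ℕₚ.+-suc c i)))

  Above-partsFrom : ∀ c L → Above c (partsFrom c L)
  Above-partsFrom c zero    = []
  Above-partsFrom c (suc L) = ℕₚ.n<1+n c ∷ ℕₚ.n<1+n c ∷ All.map (ℕₚ.<-trans (ℕₚ.n<1+n c)) (Above-partsFrom (suc c) L)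

  infix 4 _∼_

  record _∼_ (ps ps′ : List CPart) : Set where
    constructor same-series
    field series-≈ : ∀ w → partitionSeries w ps ≈ partitionSeries w ps′

  open _∼_ public

  ∼-sym : ∀ {ps ps′} → ps ∼ ps′ → ps′ ∼ ps
  ∼-sym ps∼ps′ = same-series (λ w → ≈-sym (series-≈ ps∼ps′ w))

  ∼-trans : ∀ {ps ps′ ps″} → ps ∼ ps′ → ps′ ∼ ps″ → ps ∼ ps″
  ∼-trans ps∼ps′ ps′∼ps″ = same-series (λ w → ≈-trans (series-≈ ps∼ps′ w) (series-≈ ps′∼ps″ w))

  ∷-cong : ∀ {k ps ps′} c → 1 ≤ k → ps ∼ ps′ → (k , c) ∷ ps ∼ (k , c) ∷ ps′
  ∷-cong {k} {ps} {ps′} c 1≤k ps∼ps′ = same-series (λ w → begin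
    partitionSeries w ((k , c) ∷ ps)
      ≈⟨ partitionSeries-∷ c w ps 1≤k ⟩
    ∑[ j ≤ N ] (qpow (j ℕ.* k) * partitionSeries (λ π → w (replicate j (k , c) ++ π)) ps)
      ≈⟨ Σ≤ˢ-cong N (λ j → *-congˡ (series-≈ ps∼ps′ (λ π → w (replicate j (k , c) ++ π)))) ⟩
    ∑[ j ≤ N ] (qpow (j ℕ.* k) * partitionSeries (λ π → w (replicate j (k , c) ++ π)) ps′)
      ≈⟨ partitionSeries-∷ c w ps′ 1≤k ⟨
    partitionSeries w ((k , c) ∷ ps′) ∎)

  ∷-beyond : ∀ {k ps} c → N < k → (k , c) ∷ ps ∼ ps
  ∷-beyond {k} {ps} c N<k = same-series (λ w → begin
    partitionSeries w ((k , c) ∷ ps)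
      ≈⟨ partitionSeries-∷ c w ps 1≤k ⟩
    ∑[ j ≤ N ] (qpow (j ℕ.* k) * W w j)
      ≈⟨ geometric-head 1≤k (W w) ⟩
    W w 0 + qpow k * ∑[ j ≤ N ] (qpow (j ℕ.* k) * W w (suc j))
      ≈⟨ +-congˡ (≈-trans (*-congʳ (qpow-vanish N<k)) (zeroˡ _)) ⟩
    W w 0 + 0#
      ≈⟨ +-identityʳ _ ⟩
    partitionSeries w ps ∎)
    where
    1≤k = ℕₚ.≤-trans (s≤s z≤n) N<k

    W : (List CPart → ℤ) → ℕ → Series
    W w j = partitionSeries (λ π → w (replicate j (k , c) ++ π)) ps

  pair-cong : ∀ {k ps ps′} → 1 ≤ k → ps ∼ ps′ → pair k ps ∼ pair k ps′
  pair-cong 1≤k ps∼ps′ = ∷-cong blue 1≤k (∷-cong green 1≤k ps∼ps′)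

  pair-beyond : ∀ {k ps} → N < k → pair k ps ∼ ps
  pair-beyond N<k = ∼-trans (∷-beyond blue N<k) (∷-beyond green N<k)

  partsFrom-beyond : ∀ {c} L → N ≤ c → partsFrom c L ∼ []
  partsFrom-beyond zero    _   = same-series (λ _ → ≈-refl)
  partsFrom-beyond (suc L) N≤c = ∼-trans (pair-beyond (s≤s N≤c)) (partsFrom-beyond L (ℕₚ.m≤n⇒m≤1+n N≤c))

  partsFrom-stable : ∀ c L L′ → N ≤ c ℕ.+ L → N ≤ c ℕ.+ L′ → partsFrom c L ∼ partsFrom c L′
  partsFrom-stable c zero    zero     _   _   = same-series (λ _ → ≈-refl)
  partsFrom-stable c zero    (suc L′) N≤c _   = ∼-sym (partsFrom-beyond (suc L′) (subst (N ≤_) (ℕₚ.+-identityʳ c) N≤c))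
  partsFrom-stable c (suc L) zero     _   N≤c = partsFrom-beyond (suc L) (subst (N ≤_) (ℕₚ.+-identityʳ c) N≤c)
  partsFrom-stable c (suc L) (suc L′) N≤  N≤′ = pair-cong (s≤s z≤n)
    (partsFrom-stable (suc c) L L′ (subst (N ≤_) (ℕₚ.+-suc c L) N≤) (subst (N ≤_) (ℕₚ.+-suc c L′) N≤′))

  colourSeries-[] : colourSeries [] ≈ 1#
  colourSeries-[] zero    _ = refl
  colourSeries-[] (suc n) _ = refl

  admissibleSeries-[] : admissibleSeries [] ≈ 0#
  admissibleSeries-[] zero    _ = refl
  admissibleSeries-[] (suc n) _ = refl

module Tails (N : ℕ) where

  open Truncated N
  open BasicHypergeometric N
  open ColouredPartitions
  open PartitionSeries N
  open Solver using (solve; _:*_; _:=_)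
  open import Data.Bool using (not)
  open import Relation.Binary.PropositionalEquality using (subst)

  -- Sizes above N are invisible modulo q^(N+1); the N + 2 pairs leave room to
  -- split off the sizes 2m+1 and 2m+2.
  tailParts : ℕ → List CPart
  tailParts m = partsFrom (m ℕ.+ m) (2 ℕ.+ N)

  colourTail admissibleTail : ℕ → Series
  colourTail m = colourSeries (tailParts m)
  admissibleTail m = admissibleSeries (tailParts m)

  private
    evenᵇ-suc : ∀ n → evenᵇ (suc n) ≡ not (evenᵇ n)
    evenᵇ-suc zero          = refl
    evenᵇ-suc (suc zero)    = refl
    evenᵇ-suc (suc (suc n)) = evenᵇ-suc n

    evenᵇ-m+m : ∀ m → evenᵇ (m ℕ.+ m) ≡ true
    evenᵇ-m+m zero    = refl
    evenᵇ-m+m (suc m) = trans (cong (evenᵇ ∘ suc) (ℕₚ.+-suc m m)) (evenᵇ-m+m m)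

    evenᵇ-1+m+m : ∀ m → evenᵇ (suc (m ℕ.+ m)) ≡ false
    evenᵇ-1+m+m m = trans (evenᵇ-suc (m ℕ.+ m)) (cong not (evenᵇ-m+m m))

    remainder : ℕ → List CPart
    remainder m = partsFrom (suc (suc (m ℕ.+ m))) N

    remainder∼tailParts : ∀ m → remainder m ∼ tailParts (suc m)
    remainder∼tailParts m = subst (λ c → remainder m ∼ partsFrom c (2 ℕ.+ N)) (cong suc (sym (ℕₚ.+-suc m m)))
      (partsFrom-stable c N (2 ℕ.+ N) (ℕₚ.m≤n+m N c) (ℕₚ.≤-trans (ℕₚ.m≤n+m N 2) (ℕₚ.m≤n+m (2 ℕ.+ N) c)))
      where c = suc (suc (m ℕ.+ m))

    tailParts-beyond : ∀ {m} → N ≤ m → tailParts m ∼ []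
    tailParts-beyond {m} N≤m = partsFrom-beyond (2 ℕ.+ N) (ℕₚ.≤-trans N≤m (ℕₚ.m≤m+n m m))

    I : ℕ → Series
    I m = invˢ (1# - qpow (suc (m ℕ.+ m)))

    colourTail-odd : ∀ m → colourTail m ≈ I m * (I m * colourSeries (pair (suc (suc (m ℕ.+ m))) (remainder m)))
    colourTail-odd m = colourSeries-pair-odd (s≤s z≤n) (Above-partsFrom _ (suc N)) (evenᵇ-1+m+m m)

  colourTail-rec : ∀ m → colourTail m ≈ pairFactor m * colourTail (suc m)
  colourTail-rec m = begin
    colourTail m
      ≈⟨ colourTail-odd m ⟩
    I m * (I m * colourSeries (pair k (remainder m)))
      ≈⟨ *-congˡ (*-congˡ (colourSeries-pair-even (s≤s z≤n) (Above-partsFrom k N) (evenᵇ-m+m m))) ⟩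
    I m * (I m * ((1# - qpow k) * colourSeries (remainder m)))
      ≈⟨ *-congˡ (*-congˡ (*-congˡ (series-≈ (remainder∼tailParts m) colourWeight))) ⟩
    I m * (I m * ((1# - qpow k) * colourTail (suc m)))
      ≈⟨ solve 3 (λ a b y → a :* (a :* (b :* y)) := a :* (a :* b) :* y) ≈-refl (I m) _ _ ⟩
    pairFactor m * colourTail (suc m) ∎
    where k = suc (suc (m ℕ.+ m))

  admissibleTail-rec : ∀ m → admissibleTail m ≈ qpow (suc (m ℕ.+ m)) * colourTail m + admissibleTail (suc m)
  admissibleTail-rec m = begin
    admissibleTail m
      ≈⟨ admissibleSeries-pair-odd (s≤s z≤n) (Above-partsFrom _ (suc N)) (evenᵇ-1+m+m m) ⟩
    admissibleSeries (pair k (remainder m)) + qpow (suc (m ℕ.+ m)) * (I m * (I m * colourSeries (pair k (remainder m))))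
      ≈⟨ +-cong (admissibleSeries-pair-even (s≤s z≤n) (Above-partsFrom k N) (evenᵇ-m+m m))
                (*-congˡ (≈-sym (colourTail-odd m))) ⟩
    admissibleSeries (remainder m) + qpow (suc (m ℕ.+ m)) * colourTail m
      ≈⟨ +-comm _ _ ⟩
    qpow (suc (m ℕ.+ m)) * colourTail m + admissibleSeries (remainder m)
      ≈⟨ +-congˡ (series-≈ (remainder∼tailParts m) admissibleWeight) ⟩
    qpow (suc (m ℕ.+ m)) * colourTail m + admissibleTail (suc m) ∎
    where k = suc (suc (m ℕ.+ m))

  colourTail-beyond : ∀ m → N ≤ m → colourTail m ≈ 1#
  colourTail-beyond m N≤m = ≈-trans (series-≈ (tailParts-beyond N≤m) colourWeight) colourSeries-[]

  admissibleTail-beyond : ∀ m → N ≤ m → admissibleTail m ≈ 0#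
  admissibleTail-beyond m N≤m = ≈-trans (series-≈ (tailParts-beyond N≤m) admissibleWeight) admissibleSeries-[]

  colourTail≈tailProduct : ∀ m → colourTail m ≈ tailProduct m
  colourTail≈tailProduct = ≈-by-downward-recursion pairFactor colourTail tailProduct colourTail-rec tailProduct-rec
    (λ m N≤m → ≈-trans (colourTail-beyond m N≤m) (≈-sym (tailProduct-beyond m N≤m)))

  admissibleTail-0≈q*ω : admissibleTail 0 ≈ q * ω
  admissibleTail-0≈q*ω = begin
    admissibleTail 0
      ≈⟨ Σ≤ˢ-unfold N admissibleTail _ admissibleTail-rec ⟩
    ∑[ m ≤ N ] (qpow (suc (m ℕ.+ m)) * colourTail m) + admissibleTail (suc N)
      ≈⟨ +-congˡ (admissibleTail-beyond (suc N) (ℕₚ.n≤1+n N)) ⟩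
    ∑[ m ≤ N ] (qpow (suc (m ℕ.+ m)) * colourTail m) + 0#
      ≈⟨ +-identityʳ _ ⟩
    ∑[ m ≤ N ] (qpow (suc (m ℕ.+ m)) * colourTail m)
      ≈⟨ Σ≤ˢ-cong N (λ m → *-congˡ (colourTail≈tailProduct m)) ⟩
    ∑[ m ≤ N ] (qpow (suc (m ℕ.+ m)) * tailProduct m)
      ≈⟨ q*productSum ⟨
    q * productSum q q
      ≈⟨ *-congˡ productSum≈durfeeSum ⟩
    q * durfeeSum q q
      ≈⟨ *-congˡ durfeeSum≈ω ⟩
    q * ω ∎

  Tω≡admissibleTail-0 : Tω N ≡ admissibleTail 0 N
  Tω≡admissibleTail-0 = trans (Tω≡sumOver N) (trans (cong (λ ps → admissibleSeries ps N) (allParts≡partsFrom N))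
    (series-≈ (partsFrom-stable 0 N (2 ℕ.+ N) ℕₚ.≤-refl (ℕₚ.m≤n+m N 2)) admissibleWeight N ℕₚ.≤-refl))

  q*ω-coefficient : (q * ω) N ≡ (qpow 1 *ˢ ω) N
  q*ω-coefficient = sym (*ˢ≈* q ω N ℕₚ.≤-refl)

-- The identity holds for n = 0 as well (both sides vanish).
theorem2 : (n : ℕ) → 1 ≤ n → Tω n ≡ (qpow 1 *ˢ ω) n
theorem2 n _ = begin
  Tω n                 ≡⟨ Tω≡admissibleTail-0 ⟩
  admissibleTail 0 n   ≡⟨ admissibleTail-0≈q*ω n ℕₚ.≤-refl ⟩
  (q * ω) n            ≡⟨ q*ω-coefficient ⟩
  (qpow 1 *ˢ ω) n      ∎
  where
  open Tails n
  open BasicHypergeometric n using (q)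
  open Truncated n using (_*_)
  open ≡-Reasoning
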